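{- Let $k\ge 0$ be an integer and $n=48k+38$; all arithmetic is modulo $n$. Define $c_1(r)=r$ for $0\le r\le n-1$. Define $c_2,c_3:\{0,\dots,n-1\}\to\mathbb{Z}_n$ by: for $0\le i\le 12k+9$, $c_2(2i)=30k+23+i(12k+10)$ and $c_3(2i)=30k+24+i(12k+11)$; for $0\le i\le 12k+8$, $c_2(2i+1)=12k+9+i(12k+10)$ and $c_3(2i+1)=24k+20+i(12k+11)$; and for $0\le r\le 24k+18$ and $\alpha=2,3$, $c_\alpha(n-1-r)=n-1-c_\alpha(r)$. For $\alpha=1,2,3$ let ${\cal L}_\alpha=[l_\alpha(r,j)]$ be the $n\times n$ array with $l_\alpha(r,j)\equiv c_\alpha(r)+j\pmod n$, $0\le r,j\le n-1$. Then ${\cal L}_1,{\cal L}_2,{\cal L}_3$ are three (cyclic) mutually nearly orthogonal Latin squares of order $n$, i.e. they are Latin squares and each pair of them is nearly orthogonal.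
   Context: A Latin square of order $n$ is an $n\times n$ array in which each row and each column contains each of the symbols $0,\dots,n-1$ exactly once. For Latin squares $L=[l(i,j)]$ and $M=[m(i,j)]$ of even order $n$ on symbols $\{0,\dots,n-1\}$, their superimposition is the $n\times n$ array $A=[(l(i,j),m(i,j))]$. $L$ and $M$ are nearly orthogonal if in $A$ every ordered pair $(x,y)$ with $0\le x,y\le n-1$, $x\ne y$, occurs at least once, and each ordered pair $(x,x+n/2)$ (second coordinate taken modulo $n$) occurs exactly twice. A set of Latin squares is mutually nearly orthogonal if every two of them are nearly orthogonal. -}

module Defs where

open import Data.Nat using (ℕ; zero; suc; _+_; _*_; _∸_; _≤?_; NonZero; _/_; _%_)
open import Data.Nat.DivMod using (_mod_)
open import Data.Fin using (Fin; toℕ)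
open import Data.Fin.Properties using (_≟_)
open import Data.List using (List; length; filter; allFin; concatMap; map)
open import Data.Product using (_×_; _,_; ∃; ∃-syntax)
open import Relation.Binary.PropositionalEquality using (_≡_; _≢_)
open import Relation.Nullary using (yes; no; Dec)
open import Relation.Nullary.Decidable using (_×-dec_)

Array : ℕ → Set
Array n = Fin n → Fin n → Fin n

IsLatinSquare : (n : ℕ) → Array n → Set
IsLatinSquare n L =
  (∀ (i : Fin n) (x : Fin n) →
     (∃[ j ] L i j ≡ x) × (∀ j j′ → L i j ≡ x → L i j′ ≡ x → j ≡ j′))
  ×
  (∀ (j : Fin n) (x : Fin n) →
     (∃[ i ] L i j ≡ x) × (∀ i i′ → L i j ≡ x → L i′ j ≡ x → i ≡ i′))

cells : (n : ℕ) → List (Fin n × Fin n)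
cells n = concatMap (λ i → map (λ j → (i , j)) (allFin n)) (allFin n)

occurrences : (n : ℕ) → Array n → Array n → Fin n → Fin n → ℕ
occurrences n L M x y =
  length (filter (λ c → (L (Data.Product.proj₁ c) (Data.Product.proj₂ c) ≟ x)
                          ×-dec (M (Data.Product.proj₁ c) (Data.Product.proj₂ c) ≟ y))
                 (cells n))

shiftHalf : (n : ℕ) .{{_ : NonZero n}} → Fin n → Fin n
shiftHalf n x = (toℕ x + n / 2) mod n

NearlyOrthogonal : (n : ℕ) .{{_ : NonZero n}} → Array n → Array n → Set
NearlyOrthogonal n L M =
  (∀ (x y : Fin n) → x ≢ y → ∃[ i ] ∃[ j ] (L i j ≡ x × M i j ≡ y))
  ×
  (∀ (x : Fin n) → occurrences n L M x (shiftHalf n x) ≡ 2)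

-- The order n = 48k + 38 (written 38 + 48k so that NonZero is found automatically)
order : ℕ → ℕ
order k = 38 + 48 * k

-- c_α on the first half 0 ≤ r ≤ 24k+18 (as natural numbers, before reduction mod n)
c2-half : ℕ → ℕ → ℕ
c2-half k r with r % 2
... | 0 = 30 * k + 23 + (r / 2) * (12 * k + 10)
... | _ = 12 * k + 9 + (r / 2) * (12 * k + 10)

c3-half : ℕ → ℕ → ℕ
c3-half k r with r % 2
... | 0 = 30 * k + 24 + (r / 2) * (12 * k + 11)
... | _ = 24 * k + 20 + (r / 2) * (12 * k + 11)

extend : (ℕ → ℕ → ℕ) → (k : ℕ) → Fin (order k) → Fin (order k)
extend h k r with toℕ r ≤? 24 * k + 18
... | yes _ = h k (toℕ r) mod order k
... | no _  = ((order k ∸ 1) ∸ toℕ (h k ((order k ∸ 1) ∸ toℕ r) mod order k)) mod order k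

c1 c2 c3 : (k : ℕ) → Fin (order k) → Fin (order k)
c1 k r = r
c2 k = extend c2-half k
c3 k = extend c3-half k

cyclic : (k : ℕ) → (Fin (order k) → Fin (order k)) → Array (order k)
cyclic k c r j = (toℕ (c r) + toℕ j) mod order k

L1 L2 L3 : (k : ℕ) → Array (order k)
L1 k = cyclic k (c1 k)
L2 k = cyclic k (c2 k)
L3 k = cyclic k (c3 k)

-- A cyclic array (r, j) ↦ c(r) + j is a Latin square iff c is a permutation of ℤₙ, and two
-- such arrays are nearly orthogonal iff the row differences c_β(r) − c_α(r) take every
-- nonzero value of ℤₙ, the value n/2 in exactly two rows.  Each c_α satisfies
-- c(n−1−r) = n−1−c(r), so rows r and n−1−r carry opposite differences: it suffices that on
-- the first half r < h = n/2 the values of c_α are distinct and never sum to n − 1, and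
-- that r ↦ |c_β(r) − c_α(r)| maps {0, …, h−1} bijectively onto {1, …, h}.  On the first
-- half, within each residue class of r modulo 8, c_α is an arithmetic progression modulo n
-- whose coefficients are affine in k.  Splitting these progressions into finitely many
-- blocks where no reduction modulo n occurs turns the three conditions into finitely many
-- inequalities and congruences between affine functions of k, which are decided by
-- computation uniformly in k.

module Submission where

open import Defs
open import Data.Bool.Base using (Bool; true; false)
open import Data.Bool.Properties using () renaming (_≟_ to _≟ᴮ_)
open import Data.Empty using (⊥)
open import Data.Unit.Base using (⊤; tt)
open import Data.Fin.Base using (Fin; toℕ; fromℕ<; punchOut)
open import Data.Fin.Properties
  using (toℕ-fromℕ<; toℕ-injective; toℕ<n; punchOut-injective; injective⇒≤)
  renaming (_≟_ to _≟ᶠ_; any? to anyFin?)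
open import Data.List.Base using (List; []; _∷_; _++_; map; filter; length; concatMap; allFin; cartesianProduct)
open import Data.List.Membership.Propositional using (_∈_; find)
open import Data.List.Membership.Propositional.Properties using (∈-allFin; ∈-cartesianProduct⁺)
open import Data.List.Properties using (filter-accept; filter-reject; filter-none)
open import Data.List.Relation.Unary.All as All using (All; []; _∷_; all?)
open import Data.List.Relation.Unary.Any as Any using (Any; here; there; any?; satisfied)
open import Data.List.Relation.Unary.AllPairs using (AllPairs; []; _∷_; allPairs?)
open import Data.List.Relation.Unary.Unique.Propositional using (Unique)
open import Data.List.Relation.Unary.Unique.Propositional.Properties using (allFin⁺; cartesianProduct⁺)
open import Data.Nat.Base hiding (parity)
open import Data.Nat.DivMod
open import Data.Nat.Divisibility using (_∣_; divides; _∣?_; _∣0; ∣m⇒∣m*n; ∣m∣n⇒∣m+n)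
open import Data.Nat.Properties
open import Data.Nat.Tactic.RingSolver using (solve-∀)
open import Algebra.Properties.CommutativeSemigroup +-commutativeSemigroup using (xy∙z≈xz∙y; x∙yz≈y∙xz)
open import Data.Product.Base using (∃; ∃₂; _×_; _,_; proj₁; proj₂)
open import Data.Sum.Base using (_⊎_; inj₁; inj₂; [_,_]′)
open import Function.Base using (_∘_; id)
open import Function.Definitions using (Injective)
open import Level using (0ℓ)
open import Relation.Binary.Bundles using (Setoid)
open import Relation.Binary.Structures using (IsEquivalence)
open import Relation.Binary.PropositionalEquality
import Relation.Binary.Reasoning.Setoid as SetoidReasoning
open import Relation.Nullary using (¬_; Dec; yes; no; contradiction)
open import Relation.Nullary.Decidable using (_×-dec_; _⊎-dec_; ¬?; map′; from-yes)
open import Relation.Unary using (Pred; Decidable)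

private
  variable
    a b c d m x y : ℕ

module Congruence (n : ℕ) .{{_ : NonZero n}} where

  infix 4 _≡ₙ_
  record _≡ₙ_ (a b : ℕ) : Set where
    constructor mod≡
    field %≡ : a % n ≡ b % n
  open _≡ₙ_ public

  ≡ₙ-isEquivalence : IsEquivalence _≡ₙ_
  ≡ₙ-isEquivalence = record
    { refl  = mod≡ refl
    ; sym   = λ where (mod≡ p) → mod≡ (sym p)
    ; trans = λ where (mod≡ p) (mod≡ q) → mod≡ (trans p q)
    }

  ≡ₙ-setoid : Setoid 0ℓ 0ℓ
  ≡ₙ-setoid = record { isEquivalence = ≡ₙ-isEquivalence }

  open IsEquivalence ≡ₙ-isEquivalence public
    using () renaming (refl to ≡ₙ-refl; sym to ≡ₙ-sym; trans to ≡ₙ-trans)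
  module ≡ₙ-Reasoning = SetoidReasoning ≡ₙ-setoid

  ≡⇒≡ₙ : a ≡ b → a ≡ₙ b
  ≡⇒≡ₙ refl = ≡ₙ-refl

  toℕ-mod : ∀ a → toℕ (a mod n) ≡ a % n
  toℕ-mod a = toℕ-fromℕ< (m%n<n a n)

  ≡ₙ⇒≡ : a < n → b < n → a ≡ₙ b → a ≡ b
  ≡ₙ⇒≡ a<n b<n (mod≡ p) = trans (sym (m<n⇒m%n≡m a<n)) (trans p (m<n⇒m%n≡m b<n))

  +-congʳ : ∀ c → a ≡ₙ b → a + c ≡ₙ b + c
  +-congʳ {a} {b} c (mod≡ p) = mod≡ (begin
    (a + c) % n          ≡⟨ %-distribˡ-+ a c n ⟩
    (a % n + c % n) % n  ≡⟨ cong (λ z → (z + c % n) % n) p ⟩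
    (b % n + c % n) % n  ≡⟨ %-distribˡ-+ b c n ⟨
    (b + c) % n          ∎)
    where open ≡-Reasoning

  +-congˡ : ∀ c → a ≡ₙ b → c + a ≡ₙ c + b
  +-congˡ {a} {b} c p = subst₂ _≡ₙ_ (+-comm a c) (+-comm b c) (+-congʳ c p)

  m+kn≡ₙm : ∀ m k → m + k * n ≡ₙ m
  m+kn≡ₙm m k = mod≡ ([m+kn]%n≡m%n m k n)

  m+n≡ₙm : ∀ m → m + n ≡ₙ m
  m+n≡ₙm m = mod≡ ([m+n]%n≡m%n m n)

  m%n≡ₙm : ∀ m → m % n ≡ₙ m
  m%n≡ₙm m = mod≡ (m%n%n≡m%n m n)

  m+[n∸m%n]≡ₙ0 : ∀ m → m + (n ∸ m % n) ≡ₙ 0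
  m+[n∸m%n]≡ₙ0 m = begin
    m + (n ∸ m % n)      ≈⟨ +-congʳ _ (m%n≡ₙm m) ⟨
    m % n + (n ∸ m % n)  ≡⟨ m+[n∸m]≡n (m%n≤n m n) ⟩
    n                    ≈⟨ m+n≡ₙm 0 ⟩
    0                    ∎
    where open ≡ₙ-Reasoning

  +-cancelʳ-≡ₙ : ∀ c → a + c ≡ₙ b + c → a ≡ₙ b
  +-cancelʳ-≡ₙ {a} {b} c p = begin
    a              ≡⟨ +-identityʳ a ⟨
    a + 0          ≈⟨ +-congˡ a (m+[n∸m%n]≡ₙ0 c) ⟨
    a + (c + c′)   ≡⟨ +-assoc a c c′ ⟨
    a + c + c′     ≈⟨ +-congʳ c′ p ⟩
    b + c + c′     ≡⟨ +-assoc b c c′ ⟩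
    b + (c + c′)   ≈⟨ +-congˡ b (m+[n∸m%n]≡ₙ0 c) ⟩
    b + 0          ≡⟨ +-identityʳ b ⟩
    b              ∎
    where
    c′ : ℕ
    c′ = n ∸ c % n
    open ≡ₙ-Reasoning

  infixl 6 _−ₙ_
  _−ₙ_ : ℕ → ℕ → ℕ
  x −ₙ a = (x + n ∸ a) % n

  −ₙ<n : ∀ x a → x −ₙ a < n
  −ₙ<n x a = m%n<n (x + n ∸ a) n

  −ₙ+ : ∀ x → a < n → x −ₙ a + a ≡ₙ x
  −ₙ+ {a} x a<n = begin
    (x + n ∸ a) % n + a  ≈⟨ +-congʳ a (m%n≡ₙm _) ⟩
    x + n ∸ a + a        ≡⟨ m∸n+n≡m (≤-trans (<⇒≤ a<n) (m≤n+m n x)) ⟩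
    x + n                ≈⟨ m+n≡ₙm x ⟩
    x                    ∎
    where open ≡ₙ-Reasoning

  −ₙ-unique : d < n → a < n → d + a ≡ₙ x → d ≡ x −ₙ a
  −ₙ-unique {d} {a} {x} d<n a<n p =
    ≡ₙ⇒≡ d<n (−ₙ<n x a) (+-cancelʳ-≡ₙ a (≡ₙ-trans p (≡ₙ-sym (−ₙ+ x a<n))))

  n≡ₙ0 : n ≡ₙ 0
  n≡ₙ0 = m+n≡ₙm 0

  −ₙ-inverse : a < n → b < n → a −ₙ b + (b −ₙ a) ≡ₙ 0
  −ₙ-inverse {a} {b} a<n b<n = +-cancelʳ-≡ₙ a (begin
    a −ₙ b + (b −ₙ a) + a  ≡⟨ +-assoc (a −ₙ b) (b −ₙ a) a ⟩
    a −ₙ b + (b −ₙ a + a)  ≈⟨ +-congˡ (a −ₙ b) (−ₙ+ b a<n) ⟩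
    a −ₙ b + b             ≈⟨ −ₙ+ a b<n ⟩
    a                      ∎)
    where open ≡ₙ-Reasoning

  inverse-unique : a < n → c < n → a + b ≡ₙ 0 → c + b ≡ₙ 0 → a ≡ c
  inverse-unique {b = b} a<n c<n p q = ≡ₙ⇒≡ a<n c<n (+-cancelʳ-≡ₙ b (≡ₙ-trans p (≡ₙ-sym q)))

  −ₙ-swap : b < n → c < n → a + c ≡ b + d → d −ₙ c ≡ a −ₙ b
  −ₙ-swap {b} {c} {a} {d} b<n c<n eq = sym (−ₙ-unique (−ₙ<n a b) c<n (+-cancelʳ-≡ₙ b (begin
    a −ₙ b + c + b  ≡⟨ xy∙z≈xz∙y (a −ₙ b) c b ⟩
    a −ₙ b + b + c  ≈⟨ +-congʳ c (−ₙ+ a b<n) ⟩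
    a + c           ≡⟨ trans eq (+-comm b d) ⟩
    d + b           ∎)))
    where open ≡ₙ-Reasoning

injective⇒surjective : ∀ {m} (f : Fin m → Fin m) → Injective _≡_ _≡_ f → ∀ y → ∃ λ x → f x ≡ y
injective⇒surjective f f-injective y with anyFin? (λ x → f x ≟ᶠ y)
... | yes hit = hit
injective⇒surjective {suc m} f f-injective y | no miss =
  contradiction (injective⇒≤ avoid-injective) 1+n≰n
  where
  avoid : Fin (suc m) → Fin m
  avoid x = punchOut {i = y} (λ y≡fx → miss (x , sym y≡fx))

  avoid-injective : Injective _≡_ _≡_ avoid
  avoid-injective {x} {x′} eq =
    f-injective (punchOut-injective (λ e → miss (x , sym e)) (λ e → miss (x′ , sym e)) eq)

bounded-injective⇒surjective : (f : ℕ → ℕ) → (∀ {r} → r < m → f r < m) →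
  (∀ {r r′} → r < m → r′ < m → f r ≡ f r′ → r ≡ r′) →
  y < m → ∃ λ r → r < m × f r ≡ y
bounded-injective⇒surjective {m} {y} f f<m f-injective y<m =
  let (r , gr≡y) = injective⇒surjective g g-injective (fromℕ< y<m)
  in toℕ r , toℕ<n r , trans (sym (toℕ-fromℕ< _)) (trans (cong toℕ gr≡y) (toℕ-fromℕ< y<m))
  where
  g : Fin m → Fin m
  g r = fromℕ< (f<m (toℕ<n r))

  g-injective : Injective _≡_ _≡_ g
  g-injective {r} {r′} eq = toℕ-injective (f-injective (toℕ<n r) (toℕ<n r′)
    (trans (sym (toℕ-fromℕ< _)) (trans (cong toℕ eq) (toℕ-fromℕ< _))))

module Count {A : Set} {P : Pred A 0ℓ} (P? : Decidable P) where

  count-none : ∀ {xs} → (∀ {x} → x ∈ xs → ¬ P x) → length (filter P? xs) ≡ 0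
  count-none none = cong length (filter-none P? (All.tabulate none))

  count-one : ∀ {xs a} → Unique xs → a ∈ xs → P a → (∀ {x} → x ∈ xs → P x → x ≡ a) →
    length (filter P? xs) ≡ 1
  count-one (x∉ ∷ _) (here refl) pa only = trans (cong length (filter-accept P? pa))
    (cong suc (count-none λ y∈ py → All.lookup x∉ y∈ (sym (only (there y∈) py))))
  count-one (x∉ ∷ u) (there a∈) pa only = trans (cong length (filter-reject P? ¬px))
    (count-one u a∈ pa (only ∘ there))
    where
    ¬px : ¬ P _
    ¬px px = All.lookup x∉ a∈ (only (here refl) px)

  count-two : ∀ {xs a b} → Unique xs → a ∈ xs → b ∈ xs → a ≢ b → P a → P b →
    (∀ {x} → x ∈ xs → P x → x ≡ a ⊎ x ≡ b) → length (filter P? xs) ≡ 2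
  count-two _ (here refl) (here refl) a≢b _ _ _ = contradiction refl a≢b
  count-two (x∉ ∷ u) (here refl) (there b∈) _ pa pb only =
    trans (cong length (filter-accept P? pa)) (cong suc (count-one u b∈ pb λ y∈ py →
      [ (λ y≡x → contradiction (sym y≡x) (All.lookup x∉ y∈)) , id ]′ (only (there y∈) py)))
  count-two (x∉ ∷ u) (there a∈) (here refl) _ pa pb only =
    trans (cong length (filter-accept P? pb)) (cong suc (count-one u a∈ pa λ y∈ py →
      [ id , (λ y≡x → contradiction (sym y≡x) (All.lookup x∉ y∈)) ]′ (only (there y∈) py)))
  count-two (x∉ ∷ u) (there a∈) (there b∈) a≢b pa pb only =
    trans (cong length (filter-reject P? ¬px)) (count-two u a∈ b∈ a≢b pa pb (only ∘ there))
    where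
    ¬px : ¬ P _
    ¬px px = [ All.lookup x∉ a∈ , All.lookup x∉ b∈ ]′ (only (here refl) px)

cells≡cartesianProduct : ∀ m → cells m ≡ cartesianProduct (allFin m) (allFin m)
cells≡cartesianProduct m = rows (allFin m)
  where
  rows : ∀ is → concatMap (λ i → map (i ,_) (allFin m)) is ≡ cartesianProduct is (allFin m)
  rows []       = refl
  rows (i ∷ is) = cong (map (i ,_) (allFin m) ++_) (rows is)

Superimposes : ∀ {m} → Array m → Array m → Fin m → Fin m → Fin m × Fin m → Set
Superimposes L M x y c = L (proj₁ c) (proj₂ c) ≡ x × M (proj₁ c) (proj₂ c) ≡ y

occurrences≡2 : ∀ {m} (L M : Array m) {x y : Fin m} {c₀ c₁ : Fin m × Fin m} → c₀ ≢ c₁ →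
  Superimposes L M x y c₀ → Superimposes L M x y c₁ →
  (∀ {c} → Superimposes L M x y c → c ≡ c₀ ⊎ c ≡ c₁) → occurrences m L M x y ≡ 2
occurrences≡2 {m} L M {x} {y} c₀≢c₁ p₀ p₁ only =
  subst (λ cs → length (filter P? cs) ≡ 2) (sym (cells≡cartesianProduct m))
    (Count.count-two P? (cartesianProduct⁺ (allFin⁺ m) (allFin⁺ m)) (cell∈ _) (cell∈ _)
      c₀≢c₁ p₀ p₁ (λ _ → only))
  where
  P? : Decidable (Superimposes L M x y)
  P? c = (L (proj₁ c) (proj₂ c) ≟ᶠ x) ×-dec (M (proj₁ c) (proj₂ c) ≟ᶠ y)
  cell∈ : ∀ c → c ∈ cartesianProduct (allFin m) (allFin m)
  cell∈ (i , j) = ∈-cartesianProduct⁺ (∈-allFin i) (∈-allFin j)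

module CyclicArray (n : ℕ) .{{_ : NonZero n}} where
  open Congruence n

  cyclicArray : (Fin n → Fin n) → Array n
  cyclicArray c i j = (toℕ (c i) + toℕ j) mod n

  mod≡⇒≡ₙ : ∀ {a} {x : Fin n} → a mod n ≡ x → a ≡ₙ toℕ x
  mod≡⇒≡ₙ {a} refl = mod≡ (sym (trans (m<n⇒m%n≡m (toℕ<n (a mod n))) (toℕ-fromℕ< _)))

  ≡ₙ⇒mod≡ : ∀ {a} {x : Fin n} → a ≡ₙ toℕ x → a mod n ≡ x
  ≡ₙ⇒mod≡ {x = x} (mod≡ p) = toℕ-injective (trans (toℕ-fromℕ< _) (trans p (m<n⇒m%n≡m (toℕ<n x))))

  infixl 6 _⊖_
  _⊖_ : Fin n → Fin n → Fin n
  x ⊖ a = fromℕ< (−ₙ<n (toℕ x) (toℕ a))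

  ⊖-+ : ∀ x a → toℕ (x ⊖ a) + toℕ a ≡ₙ toℕ x
  ⊖-+ x a = subst (λ z → z + toℕ a ≡ₙ toℕ x) (sym (toℕ-fromℕ< _)) (−ₙ+ (toℕ x) (toℕ<n a))

  ⊖-unique : ∀ {d a x : Fin n} → toℕ d + toℕ a ≡ₙ toℕ x → d ≡ x ⊖ a
  ⊖-unique {d} {a} p = toℕ-injective (trans (−ₙ-unique (toℕ<n d) (toℕ<n a) p) (sym (toℕ-fromℕ< _)))

  ⊖-nonzero : ∀ {x y : Fin n} → x ≢ y → 0 < toℕ (y ⊖ x)
  ⊖-nonzero {x} {y} x≢y = n≢0⇒n>0 λ y⊖x≡0 → x≢y (toℕ-injective (≡ₙ⇒≡ (toℕ<n x) (toℕ<n y)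
    (subst (λ z → z + toℕ x ≡ₙ toℕ y) y⊖x≡0 (⊖-+ y x))))

  cyclicArray-column : ∀ c i {j x} → cyclicArray c i j ≡ x → j ≡ x ⊖ c i
  cyclicArray-column c i {j} p = ⊖-unique (≡ₙ-trans (≡⇒≡ₙ (+-comm (toℕ j) (toℕ (c i)))) (mod≡⇒≡ₙ p))

  cyclicArray-⊖ : ∀ c i x → cyclicArray c i (x ⊖ c i) ≡ x
  cyclicArray-⊖ c i x = ≡ₙ⇒mod≡ (≡ₙ-trans (≡⇒≡ₙ (+-comm (toℕ (c i)) _)) (⊖-+ x (c i)))

  cyclicArray-isLatinSquare : ∀ c → Injective _≡_ _≡_ c → IsLatinSquare n (cyclicArray c)
  cyclicArray-isLatinSquare c c-injective = rows , columns
    where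
    rows : ∀ i x → (∃ λ j → cyclicArray c i j ≡ x) ×
                   (∀ j j′ → cyclicArray c i j ≡ x → cyclicArray c i j′ ≡ x → j ≡ j′)
    rows i x = (x ⊖ c i , cyclicArray-⊖ c i x) ,
               λ _ _ p q → trans (cyclicArray-column c i p) (sym (cyclicArray-column c i q))

    columns : ∀ j x → (∃ λ i → cyclicArray c i j ≡ x) ×
                      (∀ i i′ → cyclicArray c i j ≡ x → cyclicArray c i′ j ≡ x → i ≡ i′)
    columns j x =
      let (i , cᵢ≡x⊖j) = injective⇒surjective c c-injective (x ⊖ j)
      in (i , ≡ₙ⇒mod≡ (subst (λ z → toℕ z + toℕ j ≡ₙ toℕ x) (sym cᵢ≡x⊖j) (⊖-+ x j))) ,
         λ _ _ p q → c-injective (trans (⊖-unique (mod≡⇒≡ₙ p)) (sym (⊖-unique (mod≡⇒≡ₙ q))))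

  difference : (ca cb : Fin n → Fin n) → Fin n → Fin n
  difference ca cb i = cb i ⊖ ca i

  superimposed⇒difference : ∀ ca cb i {j x y} → cyclicArray ca i j ≡ x → cyclicArray cb i j ≡ y →
    difference ca cb i ≡ y ⊖ x
  superimposed⇒difference ca cb i {j} {x} {y} p q = ⊖-unique (begin
    toℕ δ + toℕ x                       ≈⟨ +-congˡ (toℕ δ) (mod≡⇒≡ₙ p) ⟨
    toℕ δ + (toℕ (ca i) + toℕ j)        ≡⟨ +-assoc (toℕ δ) _ _ ⟨
    toℕ δ + toℕ (ca i) + toℕ j          ≈⟨ +-congʳ (toℕ j) (⊖-+ (cb i) (ca i)) ⟩
    toℕ (cb i) + toℕ j                  ≈⟨ mod≡⇒≡ₙ q ⟩
    toℕ y                               ∎)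
    where
    δ : Fin n
    δ = difference ca cb i
    open ≡ₙ-Reasoning

  difference⇒superimposed : ∀ ca cb i {x y} → difference ca cb i ≡ y ⊖ x →
    Superimposes (cyclicArray ca) (cyclicArray cb) x y (i , x ⊖ ca i)
  difference⇒superimposed ca cb i {x} {y} δ≡ = cyclicArray-⊖ ca i x , ≡ₙ⇒mod≡ (begin
    toℕ (cb i) + toℕ j                  ≈⟨ +-congʳ (toℕ j) (⊖-+ (cb i) (ca i)) ⟨
    toℕ δ + toℕ (ca i) + toℕ j          ≡⟨ +-assoc (toℕ δ) _ _ ⟩
    toℕ δ + (toℕ (ca i) + toℕ j)        ≈⟨ +-congˡ (toℕ δ) (mod≡⇒≡ₙ (cyclicArray-⊖ ca i x)) ⟩
    toℕ δ + toℕ x                       ≡⟨ cong (λ z → toℕ z + toℕ x) δ≡ ⟩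
    toℕ (y ⊖ x) + toℕ x                 ≈⟨ ⊖-+ y x ⟩
    toℕ y                               ∎)
    where
    δ j : Fin n
    δ = difference ca cb i
    j = x ⊖ ca i
    open ≡ₙ-Reasoning

  half : Fin n
  half = (n / 2) mod n

  shiftHalf-⊖ : ∀ x → shiftHalf n x ⊖ x ≡ half
  shiftHalf-⊖ x = sym (⊖-unique (begin
    toℕ half + toℕ x   ≈⟨ +-congʳ (toℕ x) (mod≡⇒≡ₙ refl) ⟨
    n / 2 + toℕ x      ≡⟨ +-comm (n / 2) (toℕ x) ⟩
    toℕ x + n / 2      ≈⟨ mod≡⇒≡ₙ refl ⟩
    toℕ (shiftHalf n x) ∎))
    where open ≡ₙ-Reasoning

  HitsNonzero : (Fin n → Fin n) → Set
  HitsNonzero δ = ∀ d → 0 < toℕ d → ∃ λ i → δ i ≡ d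

  HitsExactlyTwice : (Fin n → Fin n) → Fin n → Set
  HitsExactlyTwice δ d =
    ∃₂ λ i₀ i₁ → i₀ ≢ i₁ × δ i₀ ≡ d × δ i₁ ≡ d × (∀ i → δ i ≡ d → i ≡ i₀ ⊎ i ≡ i₁)

  cyclicArray-nearlyOrthogonal : ∀ ca cb →
    HitsNonzero (difference ca cb) → HitsExactlyTwice (difference ca cb) half →
    NearlyOrthogonal n (cyclicArray ca) (cyclicArray cb)
  cyclicArray-nearlyOrthogonal ca cb hits (i₀ , i₁ , i₀≢i₁ , δ₀ , δ₁ , only) = pairs , halfPairs
    where
    pairs : ∀ x y → x ≢ y → ∃ λ i → ∃ λ j → cyclicArray ca i j ≡ x × cyclicArray cb i j ≡ y
    pairs x y x≢y =
      let (i , δᵢ) = hits (y ⊖ x) (⊖-nonzero x≢y) in i , x ⊖ ca i , difference⇒superimposed ca cb i δᵢ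

    halfPairs : ∀ x → occurrences n (cyclicArray ca) (cyclicArray cb) x (shiftHalf n x) ≡ 2
    halfPairs x = occurrences≡2 (cyclicArray ca) (cyclicArray cb) (i₀≢i₁ ∘ cong proj₁)
      (difference⇒superimposed ca cb i₀ (trans δ₀ (sym (shiftHalf-⊖ x))))
      (difference⇒superimposed ca cb i₁ (trans δ₁ (sym (shiftHalf-⊖ x))))
      onlyTwo
      where
      onlyTwo : ∀ {c} → Superimposes (cyclicArray ca) (cyclicArray cb) x (shiftHalf n x) c →
        c ≡ (i₀ , x ⊖ ca i₀) ⊎ c ≡ (i₁ , x ⊖ ca i₁)
      onlyTwo {i , j} (p , q) with only i (trans (superimposed⇒difference ca cb i p q) (shiftHalf-⊖ x))
      ... | inj₁ refl = inj₁ (cong (i ,_) (cyclicArray-column ca i p))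
      ... | inj₂ refl = inj₂ (cong (i ,_) (cyclicArray-column ca i p))

module MirrorExtension (n h : ℕ) .{{_ : NonZero n}} (h+h≡n : h + h ≡ n) where
  open Congruence n
  open CyclicArray n

  mirror : ℕ → ℕ
  mirror x = n ∸ 1 ∸ x

  record IsMirrorExtension (F : ℕ → ℕ) (c : Fin n → Fin n) : Set where
    field
      F<n   : ∀ r → F r < n
      lower : ∀ i → toℕ i < h → toℕ (c i) ≡ F (toℕ i)
      upper : ∀ i → h ≤ toℕ i → toℕ (c i) ≡ mirror (F (mirror (toℕ i)))

  0<h : 0 < h
  0<h = n≢0⇒n>0 λ h≡0 → ≢-nonZero⁻¹ n (trans (sym h+h≡n) (cong₂ _+_ h≡0 h≡0))

  h<n : h < n
  h<n = subst (h <_) h+h≡n (m<m+n h 0<h)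

  n∸h≡h : n ∸ h ≡ h
  n∸h≡h = trans (cong (_∸ h) (sym h+h≡n)) (m+n∸n≡m h h)

  h+h≡ₙ0 : h + h ≡ₙ 0
  h+h≡ₙ0 = ≡ₙ-trans (≡⇒≡ₙ h+h≡n) n≡ₙ0

  toℕ-half : toℕ half ≡ h
  toℕ-half = trans (toℕ-fromℕ< _) (trans (cong (_% n) n/2≡h) (m<n⇒m%n≡m h<n))
    where
    n/2≡h : n / 2 ≡ h
    n/2≡h = begin
      n / 2                   ≡⟨ cong (_/ 2) h+h≡n ⟨
      (h + h) / 2             ≡⟨ cong (λ z → (h + z) / 2) (+-identityʳ h) ⟨
      (2 * h) / 2             ≡⟨ cong (_/ 2) (*-comm 2 h) ⟩
      h * 2 / 2               ≡⟨ m*n/n≡m h 2 ⟩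
      h                       ∎
      where open ≡-Reasoning

  <n⇒≤n∸1 : x < n → x ≤ n ∸ 1
  <n⇒≤n∸1 {x} x<n = m+n≤o⇒m≤o∸n x (subst (_≤ n) (+-comm 1 x) x<n)

  mirror<n : ∀ x → mirror x < n
  mirror<n x = ≤-<-trans (m∸n≤m (n ∸ 1) x) (∸-monoʳ-< {o = 0} z<s (>-nonZero⁻¹ n))

  mirror-involutive : x < n → mirror (mirror x) ≡ x
  mirror-involutive x<n = m∸[m∸n]≡n (<n⇒≤n∸1 x<n)

  mirror-injective : x < n → y < n → mirror x ≡ mirror y → x ≡ y
  mirror-injective {x} {y} x<n y<n eq =
    trans (sym (mirror-involutive x<n)) (trans (cong mirror eq) (mirror-involutive y<n))

  mirror+1 : x < n → mirror x + x + 1 ≡ n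
  mirror+1 x<n = trans (cong (_+ 1) (m∸n+n≡m (<n⇒≤n∸1 x<n)))
    (trans (+-comm (n ∸ 1) 1) (m+[n∸m]≡n (>-nonZero⁻¹ n)))

  h≤mirror : x < h → h ≤ mirror x
  h≤mirror {x} x<h = m+n≤o⇒m≤o∸n h (<n⇒≤n∸1 (subst (h + x <_) h+h≡n (+-monoʳ-< h x<h)))

  mirror<h : h ≤ x → x < n → mirror x < h
  mirror<h {x} h≤x x<n = +-cancelʳ-< x (mirror x) h (begin-strict
    mirror x + x  ≡⟨ m∸n+n≡m (<n⇒≤n∸1 x<n) ⟩
    n ∸ 1         <⟨ mirror<n 0 ⟩
    n             ≡⟨ sym h+h≡n ⟩
    h + h         ≤⟨ +-monoʳ-≤ h h≤x ⟩
    h + x         ∎)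
    where open ≤-Reasoning

  mirrorExtension-injective : ∀ {F c} → IsMirrorExtension F c →
    (∀ {r r′} → r < h → r′ < h → F r ≡ F r′ → r ≡ r′) →
    (∀ {r r′} → r < h → r′ < h → F r + F r′ + 1 ≢ n) →
    Injective _≡_ _≡_ c
  mirrorExtension-injective {F} {c} ext F-injective F-unpaired {i} {i′} cᵢ≡cᵢ′ =
    toℕ-injective (by-halves (≤-<-connex h (toℕ i)) (≤-<-connex h (toℕ i′)))
    where
    open IsMirrorExtension ext
    eq : toℕ (c i) ≡ toℕ (c i′)
    eq = cong toℕ cᵢ≡cᵢ′

    paired : ∀ {r r′} → F r ≡ mirror (F r′) → F r + F r′ + 1 ≡ n
    paired {r} {r′} p = trans (cong (λ z → z + F r′ + 1) p) (mirror+1 (F<n r′))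

    by-halves : h ≤ toℕ i ⊎ toℕ i < h → h ≤ toℕ i′ ⊎ toℕ i′ < h → toℕ i ≡ toℕ i′
    by-halves (inj₂ lo) (inj₂ lo′) =
      F-injective lo lo′ (trans (sym (lower i lo)) (trans eq (lower i′ lo′)))
    by-halves (inj₁ up) (inj₁ up′) = mirror-injective (toℕ<n i) (toℕ<n i′)
      (F-injective (mirror<h up (toℕ<n i)) (mirror<h up′ (toℕ<n i′))
        (mirror-injective (F<n _) (F<n _) (trans (sym (upper i up)) (trans eq (upper i′ up′)))))
    by-halves (inj₂ lo) (inj₁ up′) = contradiction
      (paired (trans (sym (lower i lo)) (trans eq (upper i′ up′))))
      (F-unpaired lo (mirror<h up′ (toℕ<n i′)))
    by-halves (inj₁ up) (inj₂ lo′) = contradiction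
      (paired (trans (sym (lower i′ lo′)) (trans (sym eq) (upper i up))))
      (F-unpaired lo′ (mirror<h up (toℕ<n i)))

  ∥_∥ : ℕ → ℕ
  ∥ d ∥ = d ⊓ (n ∸ d)

  ∥h∥≡h : ∥ h ∥ ≡ h
  ∥h∥≡h = trans (cong (h ⊓_) n∸h≡h) (⊓-idem h)

  ∥∥-bounds : 0 < d → d < n → 1 ≤ ∥ d ∥ × ∥ d ∥ ≤ h
  ∥∥-bounds {d} 0<d d<n = ⊓-glb 0<d (m<n⇒0<n∸m d<n) , bound (≤-<-connex d h)
    where
    bound : d ≤ h ⊎ h < d → ∥ d ∥ ≤ h
    bound (inj₁ d≤h) = ≤-trans (m⊓n≤m d (n ∸ d)) d≤h
    bound (inj₂ h<d) = ≤-trans (m⊓n≤n d (n ∸ d)) (subst (n ∸ d ≤_) n∸h≡h (∸-monoʳ-≤ n (<⇒≤ h<d)))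

  ∥∥-injective : a ≤ n → b ≤ n → ∥ a ∥ ≡ ∥ b ∥ → a ≡ b ⊎ a + b ≡ n
  ∥∥-injective {a} {b} a≤n b≤n eq with ⊓-sel a (n ∸ a) | ⊓-sel b (n ∸ b)
  ... | inj₁ p | inj₁ q = inj₁ (trans (sym p) (trans eq q))
  ... | inj₁ p | inj₂ q = inj₂ (trans (cong (_+ b) (trans (sym p) (trans eq q))) (m∸n+n≡m b≤n))
  ... | inj₂ p | inj₁ q = inj₂ (trans (cong (a +_) (trans (sym q) (trans (sym eq) p))) (m+[n∸m]≡n a≤n))
  ... | inj₂ p | inj₂ q = inj₁ (trans (sym (m∸[m∸n]≡n a≤n))
    (trans (cong (n ∸_) (trans (sym p) (trans eq q))) (m∸[m∸n]≡n b≤n)))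

  ∥∥≡h⇒≡h : d < n → ∥ d ∥ ≡ h → d ≡ h
  ∥∥≡h⇒≡h {d} d<n eq with ∥∥-injective (<⇒≤ d<n) (<⇒≤ h<n) (trans eq (sym ∥h∥≡h))
  ... | inj₁ d≡h    = d≡h
  ... | inj₂ d+h≡n = +-cancelʳ-≡ h d h (trans d+h≡n (sym h+h≡n))

  record IsHalfBijection (f : ℕ → ℕ) : Set where
    field
      bounds    : ∀ {r} → r < h → 1 ≤ f r × f r ≤ h
      injective : ∀ {r r′} → r < h → r′ < h → f r ≡ f r′ → r ≡ r′

    surjective : 1 ≤ d × d ≤ h → ∃ λ r → r < h × f r ≡ d
    surjective {d} (1≤d , d≤h) =
      let (r , r<h , eq) = bounded-injective⇒surjective (λ r → f r ∸ 1) (pred<h ∘ bounds)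
                             f∸1-injective (pred<h (1≤d , d≤h))
      in r , r<h , ∸-cancelʳ-≡ (proj₁ (bounds r<h)) 1≤d eq
      where
      pred<h : ∀ {x} → 1 ≤ x × x ≤ h → x ∸ 1 < h
      pred<h (1≤x , x≤h) = <-≤-trans (∸-monoʳ-< {o = 0} (s≤s z≤n) 1≤x) x≤h

      f∸1-injective : ∀ {r r′} → r < h → r′ < h → f r ∸ 1 ≡ f r′ ∸ 1 → r ≡ r′
      f∸1-injective r<h r′<h eq =
        injective r<h r′<h (∸-cancelʳ-≡ (proj₁ (bounds r<h)) (proj₁ (bounds r′<h)) eq)

  ∥∥-offset⁺ : b < n → a ≡ₙ b + d → d ≤ h → ∥ a −ₙ b ∥ ≡ d
  ∥∥-offset⁺ {b} {a} {d} b<n a≡b+d d≤h = trans (cong ∥_∥ a−b≡d) (m≤n⇒m⊓n≡m d≤n∸d)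
    where
    d≤n∸d : d ≤ n ∸ d
    d≤n∸d = ≤-trans d≤h (subst (_≤ n ∸ d) n∸h≡h (∸-monoʳ-≤ n d≤h))
    a−b≡d : a −ₙ b ≡ d
    a−b≡d = sym (−ₙ-unique (≤-<-trans d≤h h<n) b<n (≡ₙ-trans (≡⇒≡ₙ (+-comm d b)) (≡ₙ-sym a≡b+d)))

  ∥∥-offset⁻ : b < n → b ≡ₙ a + d → 0 < d → d ≤ h → ∥ a −ₙ b ∥ ≡ d
  ∥∥-offset⁻ {b} {a} {d} b<n b≡a+d 0<d d≤h =
    trans (cong ∥_∥ a−b≡n−d) (trans (cong ((n ∸ d) ⊓_) (m∸[m∸n]≡n d≤n)) (m≥n⇒m⊓n≡n d≤n∸d))
    where
    d≤n : d ≤ n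
    d≤n = ≤-trans d≤h (<⇒≤ h<n)
    d≤n∸d : d ≤ n ∸ d
    d≤n∸d = ≤-trans d≤h (subst (_≤ n ∸ d) n∸h≡h (∸-monoʳ-≤ n d≤h))
    a−b≡n−d : a −ₙ b ≡ n ∸ d
    a−b≡n−d = sym (−ₙ-unique (∸-monoʳ-< {o = 0} 0<d d≤n) b<n (begin
      n ∸ d + b        ≈⟨ +-congˡ (n ∸ d) b≡a+d ⟩
      n ∸ d + (a + d)  ≡⟨ x∙yz≈y∙xz (n ∸ d) a d ⟩
      a + (n ∸ d + d)  ≡⟨ cong (a +_) (m∸n+n≡m d≤n) ⟩
      a + n            ≈⟨ m+n≡ₙm a ⟩
      a                ∎))
      where open ≡ₙ-Reasoning

  module Differences {Fa Fb ca cb} (extA : IsMirrorExtension Fa ca) (extB : IsMirrorExtension Fb cb)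
    (bijection : IsHalfBijection (λ r → ∥ Fb r −ₙ Fa r ∥)) where

    private
      module A = IsMirrorExtension extA
      module B = IsMirrorExtension extB
    open IsHalfBijection bijection

    D : ℕ → ℕ
    D r = Fb r −ₙ Fa r

    δ : Fin n → Fin n
    δ = difference ca cb

    lowerRow : ∀ {r} → r < h → Fin n
    lowerRow r<h = fromℕ< (<-trans r<h h<n)

    upperRow : ℕ → Fin n
    upperRow r = fromℕ< (mirror<n r)

    toℕ-lowerRow : ∀ {r} (r<h : r < h) → toℕ (lowerRow r<h) ≡ r
    toℕ-lowerRow r<h = toℕ-fromℕ< (<-trans r<h h<n)

    toℕ-upperRow : ∀ r → toℕ (upperRow r) ≡ mirror r
    toℕ-upperRow r = toℕ-fromℕ< (mirror<n r)

    D<n : ∀ r → D r < n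
    D<n r = −ₙ<n (Fb r) (Fa r)

    δ-lower : ∀ i → toℕ i < h → toℕ (δ i) ≡ D (toℕ i)
    δ-lower i lo = trans (toℕ-fromℕ< _) (cong₂ _−ₙ_ (B.lower i lo) (A.lower i lo))

    δ-upper : ∀ i → h ≤ toℕ i → toℕ (δ i) + D (mirror (toℕ i)) ≡ₙ 0
    δ-upper i up = subst (λ z → z + D r ≡ₙ 0) (sym toℕδᵢ) (−ₙ-inverse (A.F<n r) (B.F<n r))
      where
      r : ℕ
      r = mirror (toℕ i)
      toℕδᵢ : toℕ (δ i) ≡ Fa r −ₙ Fb r
      toℕδᵢ = trans (toℕ-fromℕ< _) (trans (cong₂ _−ₙ_ (B.upper i up) (A.upper i up))
        (−ₙ-swap (B.F<n r) (mirror<n (Fa r))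
          (trans (m+[n∸m]≡n (<n⇒≤n∸1 (A.F<n r))) (sym (m+[n∸m]≡n (<n⇒≤n∸1 (B.F<n r)))))))

    δ-lowerRow : ∀ {r} (r<h : r < h) → toℕ (δ (lowerRow r<h)) ≡ D r
    δ-lowerRow r<h = trans (δ-lower _ (subst (_< h) (sym (toℕ-lowerRow r<h)) r<h)) (cong D (toℕ-lowerRow r<h))

    δ-upperRow : ∀ {r} → r < h → toℕ (δ (upperRow r)) + D r ≡ₙ 0
    δ-upperRow {r} r<h = subst (λ z → toℕ (δ (upperRow r)) + D z ≡ₙ 0) mirror²r≡r
      (δ-upper (upperRow r) (subst (h ≤_) (sym (toℕ-upperRow r)) (h≤mirror r<h)))
      where
      mirror²r≡r : mirror (toℕ (upperRow r)) ≡ r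
      mirror²r≡r = trans (cong mirror (toℕ-upperRow r)) (mirror-involutive (<-trans r<h h<n))

    hitsNonzero : HitsNonzero δ
    hitsNonzero d 0<d with surjective (∥∥-bounds 0<d (toℕ<n d))
    ... | r , r<h , ∥Dr∥≡∥d∥ with ∥∥-injective (<⇒≤ (D<n r)) (<⇒≤ (toℕ<n d)) ∥Dr∥≡∥d∥
    ... | inj₁ Dr≡d   = lowerRow r<h , toℕ-injective (trans (δ-lowerRow r<h) Dr≡d)
    ... | inj₂ Dr+d≡n = upperRow r , toℕ-injective (inverse-unique (toℕ<n _) (toℕ<n d)
      (δ-upperRow r<h) (≡ₙ-trans (≡⇒≡ₙ (trans (+-comm (toℕ d) (D r)) Dr+d≡n)) n≡ₙ0))

    hitsHalfTwice : HitsExactlyTwice δ half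
    hitsHalfTwice with surjective (0<h , ≤-refl)
    ... | r₀ , r₀<h , ∥Dr₀∥≡h = lowerRow r₀<h , upperRow r₀ , rows-distinct ,
      toℕ-injective (trans (δ-lowerRow r₀<h) (trans Dr₀≡h (sym toℕ-half))) ,
      toℕ-injective (trans (inverse-unique (toℕ<n _) h<n (δ-upperRow r₀<h) h+Dr₀≡ₙ0) (sym toℕ-half)) ,
      only
      where
      Dr₀≡h : D r₀ ≡ h
      Dr₀≡h = ∥∥≡h⇒≡h (D<n r₀) ∥Dr₀∥≡h

      h+Dr₀≡ₙ0 : h + D r₀ ≡ₙ 0
      h+Dr₀≡ₙ0 = subst (λ z → h + z ≡ₙ 0) (sym Dr₀≡h) h+h≡ₙ0

      rows-distinct : lowerRow r₀<h ≢ upperRow r₀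
      rows-distinct eq = <-irrefl (trans (sym (toℕ-lowerRow r₀<h)) (trans (cong toℕ eq) (toℕ-upperRow r₀)))
        (<-≤-trans r₀<h (h≤mirror r₀<h))

      is-r₀ : ∀ {r} → r < h → D r ≡ h → r ≡ r₀
      is-r₀ r<h Dr≡h = injective r<h r₀<h (trans (cong ∥_∥ Dr≡h) (trans ∥h∥≡h (sym ∥Dr₀∥≡h)))

      only : ∀ i → δ i ≡ half → i ≡ lowerRow r₀<h ⊎ i ≡ upperRow r₀
      only i δᵢ≡half with ≤-<-connex h (toℕ i)
      ... | inj₂ lo = inj₁ (toℕ-injective (trans (is-r₀ lo Dᵢ≡h) (sym (toℕ-lowerRow r₀<h))))
        where
        Dᵢ≡h : D (toℕ i) ≡ h
        Dᵢ≡h = trans (sym (δ-lower i lo)) (trans (cong toℕ δᵢ≡half) toℕ-half)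
      ... | inj₁ up = inj₂ (toℕ-injective (trans (sym (mirror-involutive (toℕ<n i)))
          (trans (cong mirror (is-r₀ (mirror<h up (toℕ<n i)) Dr≡h)) (sym (toℕ-upperRow r₀)))))
        where
        toℕδᵢ≡h : toℕ (δ i) ≡ h
        toℕδᵢ≡h = trans (cong toℕ δᵢ≡half) toℕ-half
        Dr≡h : D (mirror (toℕ i)) ≡ h
        Dr≡h = inverse-unique (D<n _) h<n
          (≡ₙ-trans (≡⇒≡ₙ (trans (cong (_ +_) (sym toℕδᵢ≡h)) (+-comm _ (toℕ (δ i))))) (δ-upper i up))
          h+h≡ₙ0

    nearlyOrthogonal : NearlyOrthogonal n (cyclicArray ca) (cyclicArray cb)
    nearlyOrthogonal = cyclicArray-nearlyOrthogonal ca cb hitsNonzero hitsHalfTwice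

any-filter⁻ : ∀ {A : Set} {P Q : Pred A 0ℓ} (Q? : Decidable Q) {xs} →
  Any P (filter Q? xs) → Any (λ x → P x × Q x) xs
any-filter⁻ Q? {x ∷ _} p with Q? x | p
... | yes qx | here px  = here (px , qx)
... | yes _  | there p′ = there (any-filter⁻ Q? p′)
... | no _   | p′       = there (any-filter⁻ Q? p′)

any-both : ∀ {A : Set} {P Q : Pred A 0ℓ} {R : A → A → Set} {xs} → AllPairs R xs →
  Any P xs → Any Q xs → (∃ λ x → P x × Q x) ⊎ (∃₂ λ x y → P x × Q y × (R x y ⊎ R y x))
any-both _ (here px) (here qx) = inj₁ (_ , px , qx)
any-both (rs ∷ _) (here px) (there q) =
  let (y , y∈ , qy) = find q in inj₂ (_ , y , px , qy , inj₁ (All.lookup rs y∈))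
any-both (rs ∷ _) (there p) (here qx) =
  let (y , y∈ , py) = find p in inj₂ (y , _ , py , qx , inj₂ (All.lookup rs y∈))
any-both (_ ∷ rss) (there p) (there q) = any-both rss p q

any-all : ∀ {A : Set} {P Q : Pred A 0ℓ} {xs} → All P xs → Any Q xs → Any (λ x → P x × Q x) xs
any-all (px ∷ _)   (here qx) = here (px , qx)
any-all (_ ∷ pxs) (there q)  = there (any-all pxs q)

data Affine : Set where
  aff : ℕ → ℕ → Affine

⟦_⟧ : Affine → ℕ → ℕ
⟦ aff a b ⟧ k = a + b * k

constant : ℕ → Affine
constant a = aff a 0

infixl 6 _⊕_ _⊝_
infixr 7 _⊛_
infix 4 _≤ᴬ_ _≤ᴬ?_ _≟ᴬ_

_⊕_ : Affine → Affine → Affine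
aff a b ⊕ aff c d = aff (a + c) (b + d)

_⊛_ : ℕ → Affine → Affine
m ⊛ aff a b = aff (m * a) (m * b)

_⊝_ : Affine → Affine → Affine
aff a b ⊝ aff c d = aff (a ∸ c) (b ∸ d)

_≤ᴬ_ : Affine → Affine → Set
aff a b ≤ᴬ aff c d = a ≤ c × b ≤ d

_≤ᴬ?_ : ∀ x y → Dec (x ≤ᴬ y)
aff a b ≤ᴬ? aff c d = (a ≤? c) ×-dec (b ≤? d)

_≟ᴬ_ : ∀ (x y : Affine) → Dec (x ≡ y)
aff a b ≟ᴬ aff c d = map′ (λ (p , q) → cong₂ aff p q) (λ { refl → refl , refl }) ((a ≟ c) ×-dec (b ≟ d))

⟦constant⟧ : ∀ a k → ⟦ constant a ⟧ k ≡ a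
⟦constant⟧ a k = +-identityʳ a

⟦⊕⟧ : ∀ x y k → ⟦ x ⊕ y ⟧ k ≡ ⟦ x ⟧ k + ⟦ y ⟧ k
⟦⊕⟧ (aff a b) (aff c d) k = lemma a b c d k
  where
  lemma : ∀ a b c d k → a + c + (b + d) * k ≡ a + b * k + (c + d * k)
  lemma = solve-∀

⟦⊛⟧ : ∀ m x k → ⟦ m ⊛ x ⟧ k ≡ m * ⟦ x ⟧ k
⟦⊛⟧ m (aff a b) k = lemma m a b k
  where
  lemma : ∀ m a b k → m * a + m * b * k ≡ m * (a + b * k)
  lemma = solve-∀

⟦⊝⟧ : ∀ x y k → y ≤ᴬ x → ⟦ x ⊝ y ⟧ k + ⟦ y ⟧ k ≡ ⟦ x ⟧ k
⟦⊝⟧ (aff a b) (aff c d) k (c≤a , d≤b) = begin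
  a ∸ c + (b ∸ d) * k + (c + d * k)  ≡⟨ lemma (a ∸ c) (b ∸ d) c d k ⟩
  (a ∸ c + c) + (b ∸ d + d) * k      ≡⟨ cong₂ (λ u v → u + v * k) (m∸n+n≡m c≤a) (m∸n+n≡m d≤b) ⟩
  a + b * k                          ∎
  where
  open ≡-Reasoning
  lemma : ∀ a′ b′ c d k → a′ + b′ * k + (c + d * k) ≡ (a′ + c) + (b′ + d) * k
  lemma = solve-∀

⟦⟧-mono-≤ : ∀ {x y} k → x ≤ᴬ y → ⟦ x ⟧ k ≤ ⟦ y ⟧ k
⟦⟧-mono-≤ {aff a b} {aff c d} k (a≤c , b≤d) = +-mono-≤ a≤c (*-monoˡ-≤ k b≤d)

oriented : Bool → ℕ → ℕ → ℕ
oriented true  N t = t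
oriented false N t = N ∸ suc t

oriented<N : ∀ a {N t} → t < N → oriented a N t < N
oriented<N true  t<N = t<N
oriented<N false {suc N} {t} (s≤s _) = s≤s (m∸n≤m N t)

oriented-injective : ∀ a {N t t′} → t < N → t′ < N → oriented a N t ≡ oriented a N t′ → t ≡ t′
oriented-injective true  _ _ eq = eq
oriented-injective false {N} t<N t′<N eq =
  suc-injective (trans (sym (m∸[m∸n]≡n t<N)) (trans (cong (N ∸_) eq) (m∸[m∸n]≡n t′<N)))

progression-step : ∀ a d {u N} → u < N → a + d * u + d ≤ a + d * N
progression-step a d {u} {N} u<N = begin
  a + d * u + d    ≡⟨ +-assoc a (d * u) d ⟩
  a + (d * u + d)  ≡⟨ cong (a +_) (trans (+-comm (d * u) d) (sym (*-suc d u))) ⟩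
  a + d * suc u    ≤⟨ +-monoʳ-≤ a (*-monoʳ-≤ d u<N) ⟩
  a + d * N        ∎
  where open ≤-Reasoning

-- a + d t ≤ M for all t < N
UpTo : Affine → ℕ → Affine → Affine → Set
UpTo a d N M = a ⊕ d ⊛ N ≤ᴬ M ⊕ constant d

upTo? : ∀ a d N M → Dec (UpTo a d N M)
upTo? a d N M = a ⊕ d ⊛ N ≤ᴬ? M ⊕ constant d

upTo-sound : ∀ {a d N M} k {u} → UpTo a d N M → u < ⟦ N ⟧ k → ⟦ a ⟧ k + d * u ≤ ⟦ M ⟧ k
upTo-sound {a} {d} {N} {M} k {u} le u<N = +-cancelʳ-≤ d _ _ (begin
  ⟦ a ⟧ k + d * u + d       ≤⟨ progression-step (⟦ a ⟧ k) d u<N ⟩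
  ⟦ a ⟧ k + d * ⟦ N ⟧ k     ≡⟨ trans (⟦⊕⟧ a (d ⊛ N) k) (cong (⟦ a ⟧ k +_) (⟦⊛⟧ d N k)) ⟨
  ⟦ a ⊕ d ⊛ N ⟧ k           ≤⟨ ⟦⟧-mono-≤ k le ⟩
  ⟦ M ⊕ constant d ⟧ k      ≡⟨ trans (⟦⊕⟧ M (constant d) k) (cong (⟦ M ⟧ k +_) (⟦constant⟧ d k)) ⟩
  ⟦ M ⟧ k + d               ∎)
  where open ≤-Reasoning

Below : Affine → ℕ → Affine → Affine → Set
Below a = UpTo (constant 1 ⊕ a)

below? : ∀ a d N M → Dec (Below a d N M)
below? a = upTo? (constant 1 ⊕ a)

below-sound : ∀ {a d N M} k {u} → Below a d N M → u < ⟦ N ⟧ k → ⟦ a ⟧ k + d * u < ⟦ M ⟧ k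
below-sound {a} {d} k {u} le u<N = subst (λ z → z + d * u ≤ _)
  (trans (⟦⊕⟧ (constant 1) a k) (cong (_+ ⟦ a ⟧ k) (⟦constant⟧ 1 k))) (upTo-sound k le u<N)

-- x + X ≢ y + Y (for all k) whenever g divides X and Y
Incongruent : ℕ → Affine → Affine → Set
Incongruent zero      _         _         = ⊥
Incongruent g@(suc _) (aff a b) (aff c d) = g ∣ b × g ∣ d × a % g ≢ c % g

incongruent? : ∀ g x y → Dec (Incongruent g x y)
incongruent? zero      _         _         = no id
incongruent? g@(suc _) (aff a b) (aff c d) = (g ∣? b) ×-dec (g ∣? d) ×-dec ¬? (a % g ≟ c % g)

incongruent-sound : ∀ {g x y} k {X Y} → Incongruent g x y → g ∣ X → g ∣ Y → ⟦ x ⟧ k + X ≢ ⟦ y ⟧ k + Y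
incongruent-sound {g@(suc _)} {aff a b} {aff c d} k {X} {Y} (g∣b , g∣d , a≢c) g∣X g∣Y eq = a≢c (begin
  a % g                  ≡⟨ %-remove-+ʳ a (∣m∣n⇒∣m+n (∣m⇒∣m*n k g∣b) g∣X) ⟨
  (a + (b * k + X)) % g  ≡⟨ cong (_% g) (trans (sym (+-assoc a (b * k) X)) (trans eq (+-assoc c (d * k) Y))) ⟩
  (c + (d * k + Y)) % g  ≡⟨ %-remove-+ʳ c (∣m∣n⇒∣m+n (∣m⇒∣m*n k g∣d) g∣Y) ⟩
  c % g                  ∎)
  where open ≡-Reasoning

-- The rows p + 2(e + 4s) with from ≤ s < from + size, on which a function takes the values
-- low + step·t (ascending) or low + step·(size − 1 − t) (descending) at s = from + t.
record Block : Set where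
  constructor block
  field
    parity class : ℕ
    from size low : Affine
    step : ℕ
    ascending : Bool
open Block

moduli : List ℕ
moduli = 2 ∷ 3 ∷ 4 ∷ 6 ∷ 8 ∷ 12 ∷ 16 ∷ 24 ∷ []

orderᴬ halfᴬ : Affine
orderᴬ = aff 38 48
halfᴬ  = aff 19 24

Separated : Block → Block → Set
Separated b₁ b₂ =
    Below (low b₁) (step b₁) (size b₁) (low b₂)
  ⊎ Below (low b₂) (step b₂) (size b₂) (low b₁)
  ⊎ Any (λ g → g ∣ step b₁ × g ∣ step b₂ × Incongruent g (low b₁) (low b₂)) moduli

separated? : ∀ b₁ b₂ → Dec (Separated b₁ b₂)
separated? b₁ b₂ =
      below? (low b₁) (step b₁) (size b₁) (low b₂)
  ⊎-dec below? (low b₂) (step b₂) (size b₂) (low b₁)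
  ⊎-dec any? (λ g → (g ∣? step b₁) ×-dec (g ∣? step b₂) ×-dec incongruent? g (low b₁) (low b₂)) moduli

-- No value of b₁ plus a value of b₂ equals n − 1.
Unpaired : Block → Block → Set
Unpaired b₁ b₂ =
    constant 2 ⊕ (low b₁ ⊕ step b₁ ⊛ size b₁) ⊕ (low b₂ ⊕ step b₂ ⊛ size b₂)
      ≤ᴬ orderᴬ ⊕ constant (step b₁ + step b₂)
  ⊎ orderᴬ ≤ᴬ low b₁ ⊕ low b₂
  ⊎ Any (λ g → g ∣ step b₁ × g ∣ step b₂ × Incongruent g (low b₁ ⊕ low b₂ ⊕ constant 1) orderᴬ) moduli

unpaired? : ∀ b₁ b₂ → Dec (Unpaired b₁ b₂)
unpaired? b₁ b₂ =
        _ ≤ᴬ? _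
  ⊎-dec _ ≤ᴬ? _
  ⊎-dec any? (λ g → (g ∣? step b₁) ×-dec (g ∣? step b₂) ×-dec incongruent? g _ _) moduli

row : ℕ → ℕ → ℕ → ℕ
row p e s = p + (e + 4 * s) * 2

row≡8s+q : ∀ p e s → p + (e + 4 * s) * 2 ≡ 8 * s + (p + 2 * e)
row≡8s+q = solve-∀

classes : List (ℕ × ℕ)
classes = (0 , 0) ∷ (0 , 1) ∷ (0 , 2) ∷ (0 , 3) ∷ (1 , 0) ∷ (1 , 1) ∷ (1 , 2) ∷ (1 , 3) ∷ []

InClass : ℕ → ℕ → Block → Set
InClass p e b = parity b ≡ p × class b ≡ e

inClass? : ∀ p e b → Dec (InClass p e b)
inClass? p e b = (parity b ≟ p) ×-dec (class b ≟ e)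

Chained : Affine → List Block → Set
Chained s []       = ⊤
Chained s (b ∷ bs) = from b ≡ s × Chained (s ⊕ size b) bs

chained? : ∀ s bs → Dec (Chained s bs)
chained? s []       = yes tt
chained? s (b ∷ bs) = (from b ≟ᴬ s) ×-dec chained? (s ⊕ size b) bs

chainEnd : Affine → List Block → Affine
chainEnd s []       = s
chainEnd s (b ∷ bs) = chainEnd (s ⊕ size b) bs

-- The blocks of class (p, e), listed consecutively, must exhaust the rows
-- p + 2e + 8s below h.
CoversClass : List Block → ℕ × ℕ → Set
CoversClass bs (p , e) = Chained (constant 0) (filter (inClass? p e) bs) ×
  halfᴬ ≤ᴬ 8 ⊛ chainEnd (constant 0) (filter (inClass? p e) bs) ⊕ constant (p + 2 * e)

Covers : List Block → Set
Covers bs = All (CoversClass bs) classes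

covers? : ∀ bs → Dec (Covers bs)
covers? bs = all? (λ (p , e) → chained? _ _ ×-dec _ ≤ᴬ? _) classes

data Seq : Set where
  α₁ α₂ α₃ : Seq

stride : Seq → ℕ
stride α₁ = 8
stride α₂ = 2
stride α₃ = 6

-- c_α (p + 2(e + 4s)) ≡ base α p e + stride α · s (mod n), since 4(12k + 10) = n + 2 and
-- 4(12k + 11) = n + 6.
base : Seq → ℕ → ℕ → Affine
base α₁ p       e = constant (p + 2 * e)
base α₂ zero    e = aff (23 + 10 * e) (30 + 12 * e)
base α₂ (suc _) e = aff (9 + 10 * e) (12 + 12 * e)
base α₃ zero    e = aff (24 + 11 * e) (30 + 12 * e)
base α₃ (suc _) e = aff (20 + 11 * e) (24 + 12 * e)

progressionStart : Seq → Block → Affine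
progressionStart α b = base α (parity b) (class b) ⊕ stride α ⊛ from b

wraps : List ℕ
wraps = 0 ∷ 1 ∷ 2 ∷ []

SequenceBlock : Seq → Block → Set
SequenceBlock α b = parity b ≤ 1 × step b ≡ stride α × ascending b ≡ true ×
  Any (λ j → j ⊛ orderᴬ ≤ᴬ progressionStart α b × low b ≡ progressionStart α b ⊝ j ⊛ orderᴬ) wraps ×
  Below (low b) (step b) (size b) orderᴬ

sequenceBlock? : ∀ α b → Dec (SequenceBlock α b)
sequenceBlock? α b = (parity b ≤? 1) ×-dec (step b ≟ stride α) ×-dec (ascending b ≟ᴮ true) ×-dec
  any? (λ j → _ ≤ᴬ? _ ×-dec low b ≟ᴬ _) wraps ×-dec below? (low b) (step b) (size b) orderᴬ

-- y + dy·t ≡ x + dx·t + (the t-th value of b) for every t < size b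
Offset : Bool → Affine → ℕ → Affine → ℕ → Block → Set
Offset true  x dx y dy b = y ≡ x ⊕ low b × dy ≡ dx + step b
Offset false x dx y dy b = y ⊕ constant (step b) ≡ x ⊕ low b ⊕ step b ⊛ size b × dy + step b ≡ dx

offset? : ∀ a x dx y dy b → Dec (Offset a x dx y dy b)
offset? true  x dx y dy b = (y ≟ᴬ _) ×-dec (dy ≟ _)
offset? false x dx y dy b = (_ ≟ᴬ _) ×-dec (_ ≟ dx)

-- A certificate (j , true) shows c_β ≡ c_α + W and (j , false) shows c_α ≡ c_β + W (mod n)
-- on the block, W being its values; j multiples of n are added on the side of c_α.
DifferenceCertificate : Seq → Seq → Block → ℕ × Bool → Set
DifferenceCertificate α β b (j , true) =
  Offset (ascending b) (progressionStart α b ⊕ j ⊛ orderᴬ) (stride α) (progressionStart β b) (stride β) b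
DifferenceCertificate α β b (j , false) =
  Offset (ascending b) (progressionStart β b) (stride β) (progressionStart α b ⊕ j ⊛ orderᴬ) (stride α) b

differenceCertificate? : ∀ α β b c → Dec (DifferenceCertificate α β b c)
differenceCertificate? α β b (j , true)  = offset? (ascending b) _ _ _ _ b
differenceCertificate? α β b (j , false) = offset? (ascending b) _ _ _ _ b

certificates : List (ℕ × Bool)
certificates = (0 , true) ∷ (0 , false) ∷ (1 , true) ∷ (1 , false) ∷ []

InRange : Block → Set
InRange b = constant 1 ≤ᴬ low b × UpTo (low b) (step b) (size b) halfᴬ

DifferenceBlock : Seq → Seq → Block → Set
DifferenceBlock α β b = parity b ≤ 1 × 0 < step b × InRange b ×
  Any (DifferenceCertificate α β b) certificates

differenceBlock? : ∀ α β b → Dec (DifferenceBlock α β b)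
differenceBlock? α β b = (parity b ≤? 1) ×-dec (0 <? step b) ×-dec (_ ≤ᴬ? _ ×-dec upTo? (low b) (step b) (size b) halfᴬ) ×-dec
  any? (differenceCertificate? α β b) certificates

term : Block → ℕ → ℕ → ℕ
term b k u = ⟦ low b ⟧ k + step b * u

⟦⊕⊛⟧ : ∀ a d N k → ⟦ a ⊕ d ⊛ N ⟧ k ≡ ⟦ a ⟧ k + d * ⟦ N ⟧ k
⟦⊕⊛⟧ a d N k = trans (⟦⊕⟧ a (d ⊛ N) k) (cong (⟦ a ⟧ k +_) (⟦⊛⟧ d N k))

⟦⊕constant⟧ : ∀ x c k → ⟦ x ⊕ constant c ⟧ k ≡ ⟦ x ⟧ k + c
⟦⊕constant⟧ x c k = trans (⟦⊕⟧ x (constant c) k) (cong (⟦ x ⟧ k +_) (⟦constant⟧ c k))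

separated-sound : ∀ {b₁ b₂} k {u₁ u₂} → Separated b₁ b₂ → u₁ < ⟦ size b₁ ⟧ k → u₂ < ⟦ size b₂ ⟧ k →
  term b₁ k u₁ ≢ term b₂ k u₂
separated-sound k (inj₁ below) u₁<N₁ _ eq =
  <-irrefl eq (<-≤-trans (below-sound k below u₁<N₁) (m≤m+n _ _))
separated-sound k (inj₂ (inj₁ below)) _ u₂<N₂ eq =
  <-irrefl (sym eq) (<-≤-trans (below-sound k below u₂<N₂) (m≤m+n _ _))
separated-sound k {u₁} {u₂} (inj₂ (inj₂ residues)) _ _ =
  let (_ , g∣B₁ , g∣B₂ , incongruent) = satisfied residues
  in incongruent-sound k incongruent (∣m⇒∣m*n u₁ g∣B₁) (∣m⇒∣m*n u₂ g∣B₂)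

unpaired-sound : ∀ {b₁ b₂} k {u₁ u₂} → Unpaired b₁ b₂ → u₁ < ⟦ size b₁ ⟧ k → u₂ < ⟦ size b₂ ⟧ k →
  term b₁ k u₁ + term b₂ k u₂ + 1 ≢ order k
unpaired-sound {b₁} {b₂} k {u₁} {u₂} (inj₁ small) u₁<N₁ u₂<N₂ eq =
  <-irrefl eq (+-cancelʳ-≤ (B₁ + B₂) _ _ (begin
    suc (v₁ + v₂ + 1) + (B₁ + B₂)                        ≡⟨ rearrange v₁ v₂ B₁ B₂ ⟩
    2 + (v₁ + B₁) + (v₂ + B₂)                            ≤⟨ +-mono-≤ (+-monoʳ-≤ 2 (progression-step l₁ B₁ u₁<N₁))
                                                                      (progression-step l₂ B₂ u₂<N₂) ⟩
    2 + (l₁ + B₁ * ⟦ size b₁ ⟧ k) + (l₂ + B₂ * ⟦ size b₂ ⟧ k)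
      ≡⟨ cong₂ _+_ (cong (2 +_) (⟦⊕⊛⟧ (low b₁) B₁ (size b₁) k)) (⟦⊕⊛⟧ (low b₂) B₂ (size b₂) k) ⟨
    2 + ⟦ low b₁ ⊕ B₁ ⊛ size b₁ ⟧ k + ⟦ low b₂ ⊕ B₂ ⊛ size b₂ ⟧ k
      ≡⟨ trans (⟦⊕⟧ (constant 2 ⊕ (low b₁ ⊕ B₁ ⊛ size b₁)) (low b₂ ⊕ B₂ ⊛ size b₂) k)
           (cong (_+ ⟦ low b₂ ⊕ B₂ ⊛ size b₂ ⟧ k) (⟦⊕⟧ (constant 2) (low b₁ ⊕ B₁ ⊛ size b₁) k)) ⟨
    ⟦ constant 2 ⊕ (low b₁ ⊕ B₁ ⊛ size b₁) ⊕ (low b₂ ⊕ B₂ ⊛ size b₂) ⟧ k  ≤⟨ ⟦⟧-mono-≤ k small ⟩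
    ⟦ orderᴬ ⊕ constant (B₁ + B₂) ⟧ k                                  ≡⟨ ⟦⊕constant⟧ orderᴬ (B₁ + B₂) k ⟩
    order k + (B₁ + B₂)                                                ∎))
  where
  open ≤-Reasoning
  B₁ B₂ l₁ l₂ v₁ v₂ : ℕ
  B₁ = step b₁
  B₂ = step b₂
  l₁ = ⟦ low b₁ ⟧ k
  l₂ = ⟦ low b₂ ⟧ k
  v₁ = term b₁ k u₁
  v₂ = term b₂ k u₂
  rearrange : ∀ v₁ v₂ B₁ B₂ → suc (v₁ + v₂ + 1) + (B₁ + B₂) ≡ 2 + (v₁ + B₁) + (v₂ + B₂)
  rearrange = solve-∀
unpaired-sound {b₁} {b₂} k {u₁} {u₂} (inj₂ (inj₁ large)) _ _ eq =
  <-irrefl (sym eq) (≤-<-trans (begin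
    order k                ≤⟨ ⟦⟧-mono-≤ k large ⟩
    ⟦ low b₁ ⊕ low b₂ ⟧ k  ≡⟨ ⟦⊕⟧ (low b₁) (low b₂) k ⟩
    ⟦ low b₁ ⟧ k + ⟦ low b₂ ⟧ k  ≤⟨ +-mono-≤ (m≤m+n (⟦ low b₁ ⟧ k) (step b₁ * u₁)) (m≤m+n (⟦ low b₂ ⟧ k) (step b₂ * u₂)) ⟩
    term b₁ k u₁ + term b₂ k u₂  ∎) (m<m+n _ z<s))
  where open ≤-Reasoning
unpaired-sound {b₁} {b₂} k {u₁} {u₂} (inj₂ (inj₂ residues)) _ _ eq =
  let (g , g∣B₁ , g∣B₂ , incongruent) = satisfied residues
  in incongruent-sound k incongruent (∣m∣n⇒∣m+n (∣m⇒∣m*n u₁ g∣B₁) (∣m⇒∣m*n u₂ g∣B₂)) (g ∣0) (begin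
    ⟦ low b₁ ⊕ low b₂ ⊕ constant 1 ⟧ k + (step b₁ * u₁ + step b₂ * u₂)
      ≡⟨ cong (_+ (step b₁ * u₁ + step b₂ * u₂))
           (trans (⟦⊕constant⟧ (low b₁ ⊕ low b₂) 1 k) (cong (_+ 1) (⟦⊕⟧ (low b₁) (low b₂) k))) ⟩
    ⟦ low b₁ ⟧ k + ⟦ low b₂ ⟧ k + 1 + (step b₁ * u₁ + step b₂ * u₂)
      ≡⟨ rearrange (⟦ low b₁ ⟧ k) (⟦ low b₂ ⟧ k) (step b₁ * u₁) (step b₂ * u₂) ⟩
    term b₁ k u₁ + term b₂ k u₂ + 1  ≡⟨ eq ⟩
    order k                          ≡⟨ +-identityʳ (order k) ⟨
    order k + 0                      ∎)
  where
  open ≡-Reasoning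
  rearrange : ∀ l₁ l₂ x₁ x₂ → l₁ + l₂ + 1 + (x₁ + x₂) ≡ l₁ + x₁ + (l₂ + x₂) + 1
  rearrange = solve-∀

offset-sound : ∀ {x dx y dy} b k {t} → Offset (ascending b) x dx y dy b → t < ⟦ size b ⟧ k →
  ⟦ y ⟧ k + dy * t ≡ ⟦ x ⟧ k + dx * t + term b k (oriented (ascending b) (⟦ size b ⟧ k) t)
offset-sound {x} {dx} (block _ _ _ _ lo B true) k {t} (refl , refl) _ =
  trans (cong (_+ (dx + B) * t) (⟦⊕⟧ x lo k)) (rearrange (⟦ x ⟧ k) (⟦ lo ⟧ k) dx B t)
  where
  rearrange : ∀ X L dx B t → X + L + (dx + B) * t ≡ X + dx * t + (L + B * t)
  rearrange = solve-∀
offset-sound {x} {_} {y} {dy} (block _ _ _ N lo B false) k {t} (y+B≡ , refl) t<N =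
  +-cancelʳ-≡ B _ _ (begin
    ⟦ y ⟧ k + dy * t + B                         ≡⟨ xy∙z≈xz∙y (⟦ y ⟧ k) (dy * t) B ⟩
    ⟦ y ⟧ k + B + dy * t                         ≡⟨ cong (_+ dy * t) (trans (sym (⟦⊕constant⟧ y B k)) (trans
                                                      (cong (λ z → ⟦ z ⟧ k) y+B≡) (⟦⊕⊛⟧ (x ⊕ lo) B N k))) ⟩
    ⟦ x ⊕ lo ⟧ k + B * ⟦ N ⟧ k + dy * t          ≡⟨ cong₂ (λ u v → u + B * v + dy * t) (⟦⊕⟧ x lo k)
                                                      (sym (m+[n∸m]≡n t<N)) ⟩
    ⟦ x ⟧ k + ⟦ lo ⟧ k + B * (suc t + u) + dy * t ≡⟨ rearrange (⟦ x ⟧ k) (⟦ lo ⟧ k) B t u dy ⟩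
    ⟦ x ⟧ k + (dy + B) * t + (⟦ lo ⟧ k + B * u) + B ∎)
  where
  open ≡-Reasoning
  u : ℕ
  u = ⟦ N ⟧ k ∸ suc t
  rearrange : ∀ X L B t u dy → X + L + B * (suc t + u) + dy * t ≡ X + (dy + B) * t + (L + B * u) + B
  rearrange = solve-∀

inRange-sound : ∀ {b} k {u} → InRange b → u < ⟦ size b ⟧ k → 1 ≤ term b k u × term b k u ≤ ⟦ halfᴬ ⟧ k
inRange-sound {b} k (1≤low , upTo) u<N = ≤-trans (⟦⟧-mono-≤ k 1≤low) (m≤m+n _ _) , upTo-sound k upTo u<N

SequenceBlocks : Seq → List Block → Set
SequenceBlocks α bs = All (SequenceBlock α) bs × Covers bs × AllPairs Separated bs ×
  AllPairs Unpaired bs × All (λ b → Unpaired b b) bs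

sequenceBlocks? : ∀ α bs → Dec (SequenceBlocks α bs)
sequenceBlocks? α bs = all? (sequenceBlock? α) bs ×-dec covers? bs ×-dec allPairs? separated? bs ×-dec
  allPairs? unpaired? bs ×-dec all? (λ b → unpaired? b b) bs

DifferenceBlocks : Seq → Seq → List Block → Set
DifferenceBlocks α β bs = All (DifferenceBlock α β) bs × Covers bs × AllPairs Separated bs

differenceBlocks? : ∀ α β bs → Dec (DifferenceBlocks α β bs)
differenceBlocks? α β bs = all? (differenceBlock? α β) bs ×-dec covers? bs ×-dec allPairs? separated? bs

c2-half-even : ∀ k i → c2-half k (i * 2) ≡ 30 * k + 23 + i * (12 * k + 10)
c2-half-even k i with (i * 2) % 2 | m*n%n≡0 i 2
... | _ | refl = cong (λ z → 30 * k + 23 + z * (12 * k + 10)) (m*n/n≡m i 2)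

[1+i*2]/2≡i : ∀ i → (1 + i * 2) / 2 ≡ i
[1+i*2]/2≡i i = trans (+-distrib-/-∣ʳ 1 {d = 2} (divides i refl)) (m*n/n≡m i 2)

c2-half-odd : ∀ k i → c2-half k (1 + i * 2) ≡ 12 * k + 9 + i * (12 * k + 10)
c2-half-odd k i with (1 + i * 2) % 2 | [m+kn]%n≡m%n 1 i 2
... | _ | refl = cong (λ z → 12 * k + 9 + z * (12 * k + 10)) ([1+i*2]/2≡i i)

c3-half-even : ∀ k i → c3-half k (i * 2) ≡ 30 * k + 24 + i * (12 * k + 11)
c3-half-even k i with (i * 2) % 2 | m*n%n≡0 i 2
... | _ | refl = cong (λ z → 30 * k + 24 + z * (12 * k + 11)) (m*n/n≡m i 2)

c3-half-odd : ∀ k i → c3-half k (1 + i * 2) ≡ 24 * k + 20 + i * (12 * k + 11)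
c3-half-odd k i with (1 + i * 2) % 2 | [m+kn]%n≡m%n 1 i 2
... | _ | refl = cong (λ z → 24 * k + 20 + z * (12 * k + 11)) ([1+i*2]/2≡i i)

row-decomposition : ∀ r → r ≡ row (r % 2) (r / 2 % 4) (r / 2 / 4)
row-decomposition r = begin
  r                                          ≡⟨ m≡m%n+[m/n]*n r 2 ⟩
  r % 2 + r / 2 * 2                          ≡⟨ cong (λ z → r % 2 + z * 2) (m≡m%n+[m/n]*n (r / 2) 4) ⟩
  r % 2 + (r / 2 % 4 + r / 2 / 4 * 4) * 2    ≡⟨ cong (λ z → r % 2 + (r / 2 % 4 + z) * 2) (*-comm (r / 2 / 4) 4) ⟩
  row (r % 2) (r / 2 % 4) (r / 2 / 4)        ∎
  where open ≡-Reasoning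

class∈classes : ∀ {p e} → p < 2 → e < 4 → (p , e) ∈ classes
class∈classes {0} {0} _ _ = here refl
class∈classes {0} {1} _ _ = there (here refl)
class∈classes {0} {2} _ _ = there (there (here refl))
class∈classes {0} {3} _ _ = there (there (there (here refl)))
class∈classes {1} {0} _ _ = there (there (there (there (here refl))))
class∈classes {1} {1} _ _ = there (there (there (there (there (here refl)))))
class∈classes {1} {2} _ _ = there (there (there (there (there (there (here refl))))))
class∈classes {1} {3} _ _ = there (there (there (there (there (there (there (here refl)))))))
class∈classes {0} {suc (suc (suc (suc _)))} _ (s≤s (s≤s (s≤s (s≤s ()))))
class∈classes {1} {suc (suc (suc (suc _)))} _ (s≤s (s≤s (s≤s (s≤s ()))))
class∈classes {suc (suc _)} (s≤s (s≤s ())) _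

module Order (k : ℕ) where

  n h : ℕ
  n = order k
  h = 19 + 24 * k

  h+h≡n : h + h ≡ n
  h+h≡n = lemma k
    where
    lemma : ∀ k → 19 + 24 * k + (19 + 24 * k) ≡ 38 + 48 * k
    lemma = solve-∀

  open Congruence n
  open CyclicArray n
  open MirrorExtension n h h+h≡n

  halfFormula : Seq → ℕ → ℕ
  halfFormula α₁ r = r
  halfFormula α₂ r = c2-half k r
  halfFormula α₃ r = c3-half k r

  residue : Seq → ℕ → ℕ
  residue α r = halfFormula α r % n

  residue<n : ∀ α r → residue α r < n
  residue<n α r = m%n<n (halfFormula α r) n

  halfFormula-row : ∀ α {p} e s → p ≤ 1 → halfFormula α (row p e s) ≡ₙ ⟦ base α p e ⟧ k + stride α * s
  halfFormula-row α₁ {p} e s _ = ≡⇒≡ₙ (lemma p e s k)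
    where
    lemma : ∀ p e s k → p + (e + 4 * s) * 2 ≡ p + 2 * e + 0 * k + 8 * s
    lemma = solve-∀
  halfFormula-row α₂ {0} e s _ =
    ≡ₙ-trans (≡⇒≡ₙ (trans (c2-half-even k (e + 4 * s)) (lemma k e s))) (m+kn≡ₙm _ s)
    where
    lemma : ∀ k e s → 30 * k + 23 + (e + 4 * s) * (12 * k + 10)
                    ≡ 23 + 10 * e + (30 + 12 * e) * k + 2 * s + s * (38 + 48 * k)
    lemma = solve-∀
  halfFormula-row α₂ {1} e s _ =
    ≡ₙ-trans (≡⇒≡ₙ (trans (c2-half-odd k (e + 4 * s)) (lemma k e s))) (m+kn≡ₙm _ s)
    where
    lemma : ∀ k e s → 12 * k + 9 + (e + 4 * s) * (12 * k + 10)
                    ≡ 9 + 10 * e + (12 + 12 * e) * k + 2 * s + s * (38 + 48 * k)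
    lemma = solve-∀
  halfFormula-row α₃ {0} e s _ =
    ≡ₙ-trans (≡⇒≡ₙ (trans (c3-half-even k (e + 4 * s)) (lemma k e s))) (m+kn≡ₙm _ s)
    where
    lemma : ∀ k e s → 30 * k + 24 + (e + 4 * s) * (12 * k + 11)
                    ≡ 24 + 11 * e + (30 + 12 * e) * k + 6 * s + s * (38 + 48 * k)
    lemma = solve-∀
  halfFormula-row α₃ {1} e s _ =
    ≡ₙ-trans (≡⇒≡ₙ (trans (c3-half-odd k (e + 4 * s)) (lemma k e s))) (m+kn≡ₙm _ s)
    where
    lemma : ∀ k e s → 24 * k + 20 + (e + 4 * s) * (12 * k + 11)
                    ≡ 20 + 11 * e + (24 + 12 * e) * k + 6 * s + s * (38 + 48 * k)
    lemma = solve-∀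
  halfFormula-row α₂ {suc (suc _)} _ _ (s≤s ())
  halfFormula-row α₃ {suc (suc _)} _ _ (s≤s ())

  rowOf : Block → ℕ → ℕ
  rowOf b t = row (parity b) (class b) (⟦ from b ⟧ k + t)

  valueOf : Block → ℕ → ℕ
  valueOf b t = term b k (oriented (ascending b) (⟦ size b ⟧ k) t)

  Represents : (ℕ → ℕ) → Block → Set
  Represents f b = ∀ t → t < ⟦ size b ⟧ k → f (rowOf b t) ≡ valueOf b t

  residue-row : ∀ α b t → parity b ≤ 1 → residue α (rowOf b t) ≡ₙ ⟦ progressionStart α b ⟧ k + stride α * t
  residue-row α b t p≤1 = begin
    residue α (rowOf b t)                                   ≈⟨ m%n≡ₙm _ ⟩
    halfFormula α (rowOf b t)                               ≈⟨ halfFormula-row α (class b) _ p≤1 ⟩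
    B + stride α * (⟦ from b ⟧ k + t)                      ≡⟨ cong (B +_) (*-distribˡ-+ (stride α) _ t) ⟩
    B + (stride α * ⟦ from b ⟧ k + stride α * t)           ≡⟨ +-assoc B _ _ ⟨
    B + stride α * ⟦ from b ⟧ k + stride α * t             ≡⟨ cong (_+ stride α * t)
                                                                 (⟦⊕⊛⟧ (base α _ _) (stride α) (from b) k) ⟨
    ⟦ progressionStart α b ⟧ k + stride α * t               ∎
    where
    B : ℕ
    B = ⟦ base α (parity b) (class b) ⟧ k
    open ≡ₙ-Reasoning

  ⟦⊕⊛n⟧ : ∀ x j → ⟦ x ⊕ j ⊛ orderᴬ ⟧ k ≡ₙ ⟦ x ⟧ k
  ⟦⊕⊛n⟧ x j = ≡ₙ-trans (≡⇒≡ₙ (⟦⊕⊛⟧ x j orderᴬ k)) (m+kn≡ₙm (⟦ x ⟧ k) j)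

  sequenceBlock-represents : ∀ {α b} → SequenceBlock α b → Represents (residue α) b
  sequenceBlock-represents {α} {b@(block _ _ _ _ lo _ _)} (p≤1 , refl , refl , wraps , below) t t<N
    with satisfied wraps
  ... | j , j·n≤P , lo≡P−j·n = ≡ₙ⇒≡ (residue<n α _) (below-sound {lo} {stride α} {size b} {orderᴬ} k below t<N) (begin
    residue α (rowOf b t)                                ≈⟨ residue-row α b t p≤1 ⟩
    ⟦ P ⟧ k + stride α * t                               ≡⟨ cong (_+ stride α * t) (⟦⊝⟧ P (j ⊛ orderᴬ) k j·n≤P) ⟨
    ⟦ P ⊝ j ⊛ orderᴬ ⟧ k + ⟦ j ⊛ orderᴬ ⟧ k + stride α * t
      ≡⟨ cong₂ (λ u v → u + v + stride α * t) (cong (λ z → ⟦ z ⟧ k) lo≡P−j·n) (sym (⟦⊛⟧ j orderᴬ k)) ⟨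
    ⟦ lo ⟧ k + j * n + stride α * t                      ≡⟨ xy∙z≈xz∙y (⟦ lo ⟧ k) (j * n) (stride α * t) ⟩
    ⟦ lo ⟧ k + stride α * t + j * n                      ≈⟨ m+kn≡ₙm _ j ⟩
    ⟦ lo ⟧ k + stride α * t                              ∎)
    where
    P : Affine
    P = progressionStart α b
    open ≡ₙ-Reasoning

  differenceBlock-represents : ∀ {α β b} → DifferenceBlock α β b →
    Represents (λ r → ∥ residue β r −ₙ residue α r ∥) b
  differenceBlock-represents {α} {β} {b} (p≤1 , _ , inRange , certificates) t t<N =
    represented (satisfied certificates) (inRange-sound {b} k inRange (oriented<N (ascending b) t<N))
    where
    r W : ℕ
    r = rowOf b t
    W = valueOf b t
    open ≡ₙ-Reasoning

    represented : ∃ (DifferenceCertificate α β b) → 1 ≤ W × W ≤ h → ∥ residue β r −ₙ residue α r ∥ ≡ W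
    represented ((j , true) , offset) (_ , W≤h) = ∥∥-offset⁺ (residue<n α r) (begin
      residue β r                                             ≈⟨ residue-row β b t p≤1 ⟩
      ⟦ progressionStart β b ⟧ k + stride β * t               ≡⟨ offset-sound b k offset t<N ⟩
      ⟦ progressionStart α b ⊕ j ⊛ orderᴬ ⟧ k + stride α * t + W
        ≈⟨ +-congʳ W (+-congʳ (stride α * t) (⟦⊕⊛n⟧ (progressionStart α b) j)) ⟩
      ⟦ progressionStart α b ⟧ k + stride α * t + W           ≈⟨ +-congʳ W (residue-row α b t p≤1) ⟨
      residue α r + W                                         ∎) W≤h
    represented ((j , false) , offset) (0<W , W≤h) = ∥∥-offset⁻ (residue<n α r) (begin
      residue α r                                             ≈⟨ residue-row α b t p≤1 ⟩
      ⟦ progressionStart α b ⟧ k + stride α * t               ≈⟨ +-congʳ (stride α * t) (⟦⊕⊛n⟧ (progressionStart α b) j) ⟨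
      ⟦ progressionStart α b ⊕ j ⊛ orderᴬ ⟧ k + stride α * t  ≡⟨ offset-sound b k offset t<N ⟩
      ⟦ progressionStart β b ⟧ k + stride β * t + W           ≈⟨ +-congʳ W (residue-row β b t p≤1) ⟨
      residue β r + W                                         ∎) 0<W W≤h

  Located : ℕ → Block → Set
  Located r b = ∃ λ t → t < ⟦ size b ⟧ k × r ≡ rowOf b t

  chained-covers : ∀ {s x} cs → Chained s cs → ⟦ s ⟧ k ≤ x → x < ⟦ chainEnd s cs ⟧ k →
    Any (λ b → ∃ λ t → t < ⟦ size b ⟧ k × x ≡ ⟦ from b ⟧ k + t) cs
  chained-covers [] _ s≤x x<s = contradiction s≤x (<⇒≱ x<s)
  chained-covers {s} {x} (b ∷ cs) (from≡s , chained) s≤x x<end with x <? ⟦ s ⟧ k + ⟦ size b ⟧ k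
  ... | yes x<s+N = here (x ∸ ⟦ s ⟧ k ,
    +-cancelˡ-< (⟦ s ⟧ k) _ _ (subst (_< ⟦ s ⟧ k + ⟦ size b ⟧ k) (sym (m+[n∸m]≡n s≤x)) x<s+N) ,
    trans (sym (m+[n∸m]≡n s≤x)) (cong (λ z → ⟦ z ⟧ k + (x ∸ ⟦ s ⟧ k)) (sym from≡s)))
  ... | no x≮s+N = there (chained-covers cs chained
    (subst (_≤ x) (sym (⟦⊕⟧ s (size b) k)) (≮⇒≥ x≮s+N)) x<end)

  locate : ∀ {bs r} → Covers bs → r < h → Any (Located r) bs
  locate {bs} {r} covers r<h =
    Any.map (λ {b} → located {b}) (any-filter⁻ (inClass? p e) (chained-covers _ (proj₁ coverage) z≤n s<end))
    where
    p e s : ℕ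
    p = r % 2
    e = r / 2 % 4
    s = r / 2 / 4

    cs : List Block
    cs = filter (inClass? p e) bs

    coverage : CoversClass bs (p , e)
    coverage = All.lookup covers (class∈classes (m%n<n r 2) (m%n<n (r / 2) 4))

    s<end : s < ⟦ chainEnd (constant 0) cs ⟧ k
    s<end = *-cancelˡ-< 8 _ _ (+-cancelʳ-< (p + 2 * e) _ _ (begin-strict
      8 * s + (p + 2 * e)                        ≡⟨ trans (sym (row≡8s+q p e s)) (sym (row-decomposition r)) ⟩
      r                                          <⟨ r<h ⟩
      h                                          ≤⟨ ⟦⟧-mono-≤ k (proj₂ coverage) ⟩
      ⟦ 8 ⊛ chainEnd (constant 0) cs ⊕ constant (p + 2 * e) ⟧ k
        ≡⟨ trans (⟦⊕constant⟧ (8 ⊛ chainEnd (constant 0) cs) (p + 2 * e) k)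
             (cong (_+ (p + 2 * e)) (⟦⊛⟧ 8 (chainEnd (constant 0) cs) k)) ⟩
      8 * ⟦ chainEnd (constant 0) cs ⟧ k + (p + 2 * e)  ∎))
      where open ≤-Reasoning

    located : ∀ {b} → (∃ λ t → t < ⟦ size b ⟧ k × s ≡ ⟦ from b ⟧ k + t) × InClass p e b → Located r b
    located {b} ((t , t<N , s≡) , p≡ , e≡) = t , t<N , trans (row-decomposition r)
      (trans (cong (row p e) s≡) (sym (cong₂ (λ u v → row u v (⟦ from b ⟧ k + t)) p≡ e≡)))

  blocks-injective : ∀ {f bs} → All (λ b → Represents f b × 0 < step b) bs → Covers bs →
    AllPairs Separated bs → ∀ {r r′} → r < h → r′ < h → f r ≡ f r′ → r ≡ r′
  blocks-injective valid covers separated {r} {r′} r<h r′<h fr≡fr′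
    with any-both separated (any-all valid (locate covers r<h)) (any-all valid (locate covers r′<h))
  ... | inj₁ (b , ((represents , 0<B) , t , t<N , refl) , (_ , t′ , t′<N , refl)) =
    cong (rowOf b) (oriented-injective (ascending b) t<N t′<N (*-cancelˡ-≡ _ _ (step b) {{>-nonZero 0<B}}
      (+-cancelˡ-≡ (⟦ low b ⟧ k) _ _ (trans (sym (represents t t<N)) (trans fr≡fr′ (represents t′ t′<N))))))
  ... | inj₂ (b₁ , b₂ , ((represents₁ , _) , t₁ , t₁<N , refl) , ((represents₂ , _) , t₂ , t₂<N , refl) , inj₁ sep) =
    contradiction (trans (sym (represents₁ t₁ t₁<N)) (trans fr≡fr′ (represents₂ t₂ t₂<N)))
      (separated-sound {b₁} {b₂} k sep (oriented<N (ascending b₁) t₁<N) (oriented<N (ascending b₂) t₂<N))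
  ... | inj₂ (b₁ , b₂ , ((represents₁ , _) , t₁ , t₁<N , refl) , ((represents₂ , _) , t₂ , t₂<N , refl) , inj₂ sep) =
    contradiction (trans (sym (represents₂ t₂ t₂<N)) (trans (sym fr≡fr′) (represents₁ t₁ t₁<N)))
      (separated-sound {b₂} {b₁} k sep (oriented<N (ascending b₂) t₂<N) (oriented<N (ascending b₁) t₁<N))

  blocks-bounded : ∀ {f bs} → All (λ b → Represents f b × InRange b) bs → Covers bs →
    ∀ {r} → r < h → 1 ≤ f r × f r ≤ h
  blocks-bounded valid covers {r} r<h with satisfied (any-all valid (locate covers r<h))
  ... | b , (represents , inRange) , t , t<N , refl =
    subst (λ v → 1 ≤ v × v ≤ h) (sym (represents t t<N)) (inRange-sound {b} k inRange (oriented<N (ascending b) t<N))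

  blocks-unpaired : ∀ {f bs} → All (λ b → Represents f b × Unpaired b b) bs → Covers bs →
    AllPairs Unpaired bs → ∀ {r r′} → r < h → r′ < h → f r + f r′ + 1 ≢ n
  blocks-unpaired valid covers unpaired {r} {r′} r<h r′<h
    with any-both unpaired (any-all valid (locate covers r<h)) (any-all valid (locate covers r′<h))
  ... | inj₁ (b , ((represents , self) , t , t<N , refl) , (_ , t′ , t′<N , refl)) =
    subst₂ (λ v v′ → v + v′ + 1 ≢ n) (sym (represents t t<N)) (sym (represents t′ t′<N))
      (unpaired-sound {b} {b} k self (oriented<N (ascending b) t<N) (oriented<N (ascending b) t′<N))
  ... | inj₂ (b₁ , b₂ , ((represents₁ , _) , t₁ , t₁<N , refl) , ((represents₂ , _) , t₂ , t₂<N , refl) , inj₁ u) =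
    subst₂ (λ v v′ → v + v′ + 1 ≢ n) (sym (represents₁ t₁ t₁<N)) (sym (represents₂ t₂ t₂<N))
      (unpaired-sound {b₁} {b₂} k u (oriented<N (ascending b₁) t₁<N) (oriented<N (ascending b₂) t₂<N))
  ... | inj₂ (b₁ , b₂ , ((represents₁ , _) , t₁ , t₁<N , refl) , ((represents₂ , _) , t₂ , t₂<N , refl) , inj₂ u) =
    subst₂ (λ v v′ → v + v′ + 1 ≢ n) (sym (represents₁ t₁ t₁<N)) (sym (represents₂ t₂ t₂<N))
      (λ eq → unpaired-sound {b₂} {b₁} k u (oriented<N (ascending b₂) t₂<N) (oriented<N (ascending b₁) t₁<N)
        (trans (cong (_+ 1) (+-comm (valueOf b₂ t₂) (valueOf b₁ t₁))) eq))

  sequence : Seq → Fin n → Fin n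
  sequence α₁ = c1 k
  sequence α₂ = c2 k
  sequence α₃ = c3 k

  <h⇒≤24k+18 : x < h → x ≤ 24 * k + 18
  <h⇒≤24k+18 {x} (s≤s x≤18+24k) = subst (x ≤_) (+-comm 18 (24 * k)) x≤18+24k

  ≤24k+18⇒<h : x ≤ 24 * k + 18 → x < h
  ≤24k+18⇒<h {x} x≤24k+18 = s≤s (subst (x ≤_) (+-comm (24 * k) 18) x≤24k+18)

  extend-isMirrorExtension : ∀ F → IsMirrorExtension (λ r → F k r % n) (extend F k)
  extend-isMirrorExtension F = record { F<n = λ r → m%n<n (F k r) n ; lower = lower ; upper = upper }
    where
    lower : ∀ i → toℕ i < h → toℕ (extend F k i) ≡ F k (toℕ i) % n
    lower i i<h with toℕ i ≤? 24 * k + 18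
    ... | yes _  = toℕ-mod (F k (toℕ i))
    ... | no i≰ = contradiction (<h⇒≤24k+18 i<h) i≰

    upper : ∀ i → h ≤ toℕ i → toℕ (extend F k i) ≡ mirror (F k (mirror (toℕ i)) % n)
    upper i h≤i with toℕ i ≤? 24 * k + 18
    ... | yes i≤ = contradiction h≤i (<⇒≱ (≤24k+18⇒<h i≤))
    ... | no _   = trans (toℕ-mod (mirror (toℕ (Fᵢ mod n))))
      (trans (m<n⇒m%n≡m (mirror<n (toℕ (Fᵢ mod n)))) (cong mirror (toℕ-mod Fᵢ)))
      where
      Fᵢ : ℕ
      Fᵢ = F k (mirror (toℕ i))

  sequence-isMirrorExtension : ∀ α → IsMirrorExtension (residue α) (sequence α)
  sequence-isMirrorExtension α₁ = record
    { F<n   = residue<n α₁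
    ; lower = λ i _ → sym (m<n⇒m%n≡m (toℕ<n i))
    ; upper = λ i _ → sym (trans (cong mirror (m<n⇒m%n≡m (mirror<n (toℕ i)))) (mirror-involutive (toℕ<n i)))
    }
  sequence-isMirrorExtension α₂ = extend-isMirrorExtension c2-half
  sequence-isMirrorExtension α₃ = extend-isMirrorExtension c3-half

  sequenceBlock-increasing : ∀ {α b} → SequenceBlock α b → 0 < step b
  sequenceBlock-increasing {α₁} (_ , refl , _) = z<s
  sequenceBlock-increasing {α₂} (_ , refl , _) = z<s
  sequenceBlock-increasing {α₃} (_ , refl , _) = z<s

  sequence-injective : ∀ {α bs} → SequenceBlocks α bs → Injective _≡_ _≡_ (sequence α)
  sequence-injective {α} (valid , covers , separated , unpaired , unpaired-self) =
    mirrorExtension-injective (sequence-isMirrorExtension α)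
      (blocks-injective {residue α} (All.map (λ {b} v → sequenceBlock-represents {α} {b} v , sequenceBlock-increasing {α} {b} v) valid)
        covers separated)
      (blocks-unpaired {residue α} (All.zip (All.map (λ {b} → sequenceBlock-represents {α} {b}) valid , unpaired-self)) covers unpaired)

  pair-nearlyOrthogonal : ∀ {α β bs} → DifferenceBlocks α β bs →
    NearlyOrthogonal n (cyclicArray (sequence α)) (cyclicArray (sequence β))
  pair-nearlyOrthogonal {α} {β} (valid , covers , separated) =
    Differences.nearlyOrthogonal (sequence-isMirrorExtension α) (sequence-isMirrorExtension β) (record
      { bounds    = blocks-bounded {D}
          (All.map (λ {b} v@(_ , _ , inRange , _) → differenceBlock-represents {α} {β} {b} v , inRange) valid)
          covers
      ; injective = blocks-injective {D}
          (All.map (λ {b} v@(_ , 0<B , _) → differenceBlock-represents {α} {β} {b} v , 0<B) valid)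
          covers separated
      })
    where
    D : ℕ → ℕ
    D r = ∥ residue β r −ₙ residue α r ∥

blocks₂ : List Block
blocks₂ =
    block 0 0 (aff 0 0) (aff 3 3) (aff 23 30) 2 true
  ∷ block 0 1 (aff 0 0) (aff 3 3) (aff 33 42) 2 true
  ∷ block 0 2 (aff 0 0) (aff 2 3) (aff 5 6) 2 true
  ∷ block 0 3 (aff 0 0) (aff 2 3) (aff 15 18) 2 true
  ∷ block 1 0 (aff 0 0) (aff 3 3) (aff 9 12) 2 true
  ∷ block 1 1 (aff 0 0) (aff 2 3) (aff 19 24) 2 true
  ∷ block 1 2 (aff 0 0) (aff 2 3) (aff 29 36) 2 true
  ∷ block 1 3 (aff 0 0) (aff 2 3) (aff 1 0) 2 true
  ∷ []

blocks₃ : List Block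
blocks₃ =
    block 0 0 (aff 0 0) (aff 3 3) (aff 24 30) 6 true
  ∷ block 0 1 (aff 0 0) (aff 1 1) (aff 35 42) 6 true
  ∷ block 0 1 (aff 1 1) (aff 2 2) (aff 3 0) 6 true
  ∷ block 0 2 (aff 0 0) (aff 2 3) (aff 8 6) 6 true
  ∷ block 0 3 (aff 0 0) (aff 2 3) (aff 19 18) 6 true
  ∷ block 1 0 (aff 0 0) (aff 3 3) (aff 20 24) 6 true
  ∷ block 1 1 (aff 0 0) (aff 2 2) (aff 31 36) 6 true
  ∷ block 1 1 (aff 2 2) (aff 0 1) (aff 5 0) 6 true
  ∷ block 1 2 (aff 0 0) (aff 2 3) (aff 4 0) 6 true
  ∷ block 1 3 (aff 0 0) (aff 2 3) (aff 15 12) 6 true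
  ∷ []

blocks₁₂ : List Block
blocks₁₂ =
    block 0 0 (aff 0 0) (aff 1 1) (aff 15 18) 6 true
  ∷ block 0 0 (aff 1 1) (aff 2 2) (aff 11 12) 6 false
  ∷ block 0 1 (aff 0 0) (aff 2 3) (aff 7 6) 6 true
  ∷ block 0 1 (aff 2 3) (aff 1 0) (aff 19 24) 6 false
  ∷ block 0 2 (aff 0 0) (aff 1 1) (aff 1 0) 6 false
  ∷ block 0 2 (aff 1 1) (aff 1 2) (aff 5 0) 6 true
  ∷ block 0 3 (aff 0 0) (aff 2 3) (aff 3 0) 6 false
  ∷ block 1 0 (aff 0 0) (aff 2 2) (aff 2 0) 6 false
  ∷ block 1 0 (aff 2 2) (aff 1 1) (aff 4 0) 6 true
  ∷ block 1 1 (aff 0 0) (aff 2 3) (aff 10 6) 6 false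
  ∷ block 1 2 (aff 0 0) (aff 1 2) (aff 14 12) 6 true
  ∷ block 1 2 (aff 1 2) (aff 1 1) (aff 18 18) 6 false
  ∷ block 1 3 (aff 0 0) (aff 2 3) (aff 6 0) 6 true
  ∷ []

blocks₁₃ : List Block
blocks₁₃ =
    block 0 0 (aff 0 0) (aff 3 3) (aff 14 18) 2 true
  ∷ block 0 1 (aff 0 0) (aff 1 1) (aff 5 6) 2 true
  ∷ block 0 1 (aff 1 1) (aff 2 2) (aff 7 8) 2 true
  ∷ block 0 2 (aff 0 0) (aff 2 3) (aff 2 0) 2 false
  ∷ block 0 3 (aff 0 0) (aff 2 3) (aff 11 12) 2 false
  ∷ block 1 0 (aff 0 0) (aff 3 3) (aff 15 18) 2 false
  ∷ block 1 1 (aff 0 0) (aff 2 2) (aff 10 12) 2 true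
  ∷ block 1 1 (aff 2 2) (aff 0 1) (aff 14 16) 2 true
  ∷ block 1 2 (aff 0 0) (aff 2 3) (aff 1 0) 2 true
  ∷ block 1 3 (aff 0 0) (aff 2 3) (aff 6 6) 2 false
  ∷ []

blocks₂₃ : List Block
blocks₂₃ =
    block 0 0 (aff 0 0) (aff 3 3) (aff 1 0) 4 true
  ∷ block 0 1 (aff 0 0) (aff 1 1) (aff 2 0) 4 true
  ∷ block 0 1 (aff 1 1) (aff 2 2) (aff 6 4) 4 true
  ∷ block 0 2 (aff 0 0) (aff 2 3) (aff 3 0) 4 true
  ∷ block 0 3 (aff 0 0) (aff 2 3) (aff 4 0) 4 true
  ∷ block 1 0 (aff 0 0) (aff 3 3) (aff 11 12) 4 true
  ∷ block 1 1 (aff 0 0) (aff 2 2) (aff 12 12) 4 true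
  ∷ block 1 1 (aff 2 2) (aff 0 1) (aff 20 20) 4 true
  ∷ block 1 2 (aff 0 0) (aff 2 3) (aff 13 12) 4 true
  ∷ block 1 3 (aff 0 0) (aff 2 3) (aff 14 12) 4 true
  ∷ []

blocks₂-certified : SequenceBlocks α₂ blocks₂
blocks₂-certified = from-yes (sequenceBlocks? α₂ blocks₂)

blocks₃-certified : SequenceBlocks α₃ blocks₃
blocks₃-certified = from-yes (sequenceBlocks? α₃ blocks₃)

blocks₁₂-certified : DifferenceBlocks α₁ α₂ blocks₁₂
blocks₁₂-certified = from-yes (differenceBlocks? α₁ α₂ blocks₁₂)

blocks₁₃-certified : DifferenceBlocks α₁ α₃ blocks₁₃
blocks₁₃-certified = from-yes (differenceBlocks? α₁ α₃ blocks₁₃)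

blocks₂₃-certified : DifferenceBlocks α₂ α₃ blocks₂₃
blocks₂₃-certified = from-yes (differenceBlocks? α₂ α₃ blocks₂₃)

theorem5 : ∀ (k : ℕ) →
    IsLatinSquare (order k) (L1 k) × IsLatinSquare (order k) (L2 k) × IsLatinSquare (order k) (L3 k)
    × NearlyOrthogonal (order k) (L1 k) (L2 k)
    × NearlyOrthogonal (order k) (L1 k) (L3 k)
    × NearlyOrthogonal (order k) (L2 k) (L3 k)
theorem5 k =
  cyclicArray-isLatinSquare (c1 k) id ,
  cyclicArray-isLatinSquare (c2 k) (sequence-injective blocks₂-certified) ,
  cyclicArray-isLatinSquare (c3 k) (sequence-injective blocks₃-certified) ,
  pair-nearlyOrthogonal blocks₁₂-certified ,
  pair-nearlyOrthogonal blocks₁₃-certified ,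
  pair-nearlyOrthogonal blocks₂₃-certified
  where
  open Order k
  open CyclicArray (order k)
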